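{- For every nonnegative integer $n$ and every positive integer $k$, $$\frac{\det\left(\binom{2n+2i+2j}{n+i+j}\right)_{i,j=0}^{k-1}}{2^{k-1}}=2^n\prod_{j=1}^{n-1}\frac{\binom{2k-1+2j}{j}}{\binom{2j}{j}}.$$
   Context: An empty product equals $1$. -}

module Defs where

open import Data.Nat as ℕ using (ℕ; zero; suc)
open import Data.Nat.Combinatorics using (_C_)
open import Data.Fin using (Fin; zero; suc; toℕ; punchIn)
open import Data.Integer as ℤ using (ℤ; +_; -_)

sumFin : ∀ n → (Fin n → ℤ) → ℤ
sumFin zero    f = + 0
sumFin (suc n) f = f zero ℤ.+ sumFin n (λ i → f (suc i))

prod1to : ℕ → (ℕ → ℕ) → ℕ
prod1to zero    g = 1
prod1to (suc m) g = prod1to m g ℕ.* g (suc m)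

sign : ℕ → ℤ
sign zero          = + 1
sign (suc zero)    = - (+ 1)
sign (suc (suc i)) = sign i

minor : ∀ {n} → (Fin (suc n) → Fin (suc n) → ℤ) → Fin (suc n) → Fin n → Fin n → ℤ
minor M j r c = M (suc r) (punchIn j c)

det : ∀ n → (Fin n → Fin n → ℤ) → ℤ
det zero    M = + 1
det (suc n) M = sumFin (suc n) (λ j → sign (toℕ j) ℤ.* (M zero j ℤ.* det n (minor M j)))

hankelMatrix : ℕ → ∀ k → Fin k → Fin k → ℤ
hankelMatrix n k i j =
  + ((2 ℕ.* n ℕ.+ 2 ℕ.* toℕ i ℕ.+ 2 ℕ.* toℕ j) C (n ℕ.+ toℕ i ℕ.+ toℕ j))

-- Write F a m = (2m)!/(m!(m+a)!) and H a n k for the determinant of the k×k Hankel matrix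
-- (F a (n+i+j)); the theorem is about H 0 n k.  Subtracting from each column a suitable multiple
-- of the previous one clears the first row and turns the rest into a row- and column-rescaled copy
-- of the Hankel matrix with parameters (a+1, n+1).  This condensation identity expresses
-- H a n (k+1) through H (a+1) (n+1) k, and by induction on k it yields closed ratios for the
-- shifts n ↦ n+1 and a ↦ a+1.  Together with H 0 0 (k+1) = 2^k H 1 1 k, the two shifts show by
-- induction on k that the Catalan determinants H 1 0 and H 1 1 equal 1, so H 0 0 (k+1) = 2^k;
-- the n-shift at a = 0 then gives the theorem by induction on n, the
-- remaining identities between products of factorials being checked in ℕ after clearing
-- denominators.  Determinants are computed over ℚ, where the column operations live.

module Submission where

open import Defs
open import Data.Nat as ℕ using (ℕ; suc; _∸_; _^_)
open import Data.Nat.Combinatorics using (_C_; nCk≡n!/k![n-k]!; k![n∸k]!∣n!)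
open import Data.Integer as ℤ using (ℤ; +_)
open import Data.Nat.Base using (zero; _!; _≤_; _<_; s≤s; z≤n; NonZero)
import Data.Nat.Properties as ℕP
open ℕP using (_≤?_)
open import Data.Nat.Coprimality using (1-coprimeTo) renaming (sym to coprime-sym)
open import Data.Nat.DivMod using (m/n*n≡m)
import Data.Nat.Tactic.RingSolver as ℕ-Solver
import Data.Integer.Properties as ℤP
import Data.Integer.Tactic.RingSolver as ℤ-Solver
open import Data.Fin as Fin using (Fin; zero; suc; toℕ; punchIn; punchOut; inject₁; fromℕ<)
import Data.Fin.Properties as FinP
open import Data.Rational as ℚ using (ℚ; mkℚ; 0ℚ; 1ℚ; _+_; _*_; -_; 1/_)
import Data.Rational.Properties as ℚP
import Data.Rational.Unnormalised as ℚᵘ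
import Data.Rational.Unnormalised.Properties as ℚᵘP
open import Data.Rational.Solver using (module +-*-Solver)
open import Algebra.Bundles using (CommutativeRing)
open import Algebra.Properties.Semiring.Sum (CommutativeRing.semiring ℚP.+-*-commutativeRing)
  using (sum; sum-cong-≗; ∑-distrib-+; *-distribˡ-sum)
open import Algebra.Properties.CommutativeMonoid.Sum ℚP.*-1-commutativeMonoid
  using () renaming (sum to prod; sum-remove to prod-remove)
open import Data.Product using (Σ; _,_; _×_)
open import Data.Sum using (_⊎_; inj₁; inj₂)
open import Data.Empty using (⊥-elim)
open import Function using (_∘_)
open import Relation.Nullary using (yes; no)
open import Relation.Binary.PropositionalEquality

open ≡-Reasoning
open +-*-Solver

-- z/1 needs no normalisation; fromℤ is opaque so that its values stay atoms for unification.
opaque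
  fromℤ : ℤ → ℚ
  fromℤ z = mkℚ z 0 (coprime-sym (1-coprimeTo ℤ.∣ z ∣))

fromℕ : ℕ → ℚ
fromℕ n = fromℤ (+ n)

opaque
  unfolding fromℤ

  fromℕ-nonZero : ∀ n .{{_ : ℕ.NonZero n}} → ℚ.NonZero (fromℕ n)
  fromℕ-nonZero (suc n) = _

  fromℤ-+ : ∀ a b → fromℤ (a ℤ.+ b) ≡ fromℤ a + fromℤ b
  fromℤ-+ a b = ℚP.toℚᵘ-injective
    (ℚᵘP.≃-trans (ℚᵘ.*≡* (cross a b)) (ℚᵘP.≃-sym (ℚP.toℚᵘ-homo-+ (fromℤ a) (fromℤ b))))
    where
    cross : ∀ a b → (a ℤ.+ b) ℤ.* + 1 ≡ (a ℤ.* + 1 ℤ.+ b ℤ.* + 1) ℤ.* + 1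
    cross = ℤ-Solver.solve-∀

  fromℤ-* : ∀ a b → fromℤ (a ℤ.* b) ≡ fromℤ a * fromℤ b
  fromℤ-* a b = ℚP.toℚᵘ-injective
    (ℚᵘP.≃-trans (ℚᵘ.*≡* refl) (ℚᵘP.≃-sym (ℚP.toℚᵘ-homo-* (fromℤ a) (fromℤ b))))

  fromℤ-neg : ∀ a → fromℤ (ℤ.- a) ≡ - fromℤ a
  fromℤ-neg a = ℚP.toℚᵘ-injective (ℚᵘP.≃-sym (ℚP.toℚᵘ-homo‿- (fromℤ a)))

  fromℤ-injective : ∀ {a b} → fromℤ a ≡ fromℤ b → a ≡ b
  fromℤ-injective refl = refl

  fromℕ-0 : fromℕ 0 ≡ 0ℚ
  fromℕ-0 = refl

  fromℕ-1 : fromℕ 1 ≡ 1ℚ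
  fromℕ-1 = refl

instance
  fromℕ-suc-nonZero : ∀ {n} → ℚ.NonZero (fromℕ (suc n))
  fromℕ-suc-nonZero {n} = fromℕ-nonZero (suc n)

fromℕ-+ : ∀ m n → fromℕ (m ℕ.+ n) ≡ fromℕ m + fromℕ n
fromℕ-+ m n = fromℤ-+ (+ m) (+ n)

fromℕ-* : ∀ m n → fromℕ (m ℕ.* n) ≡ fromℕ m * fromℕ n
fromℕ-* m n = trans (cong fromℤ (ℤP.pos-* m n)) (fromℤ-* (+ m) (+ n))

Matrix : ℕ → Set
Matrix n = Fin n → Fin n → ℚ

minorℚ : ∀ {n} → Matrix (suc n) → Fin (suc n) → Matrix n
minorℚ M j r c = M (suc r) (punchIn j c)

signℚ : ℕ → ℚ
signℚ i = fromℤ (sign i)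

detℚ : ∀ n → Matrix n → ℚ
laplaceTerm : ∀ {n} → Matrix (suc n) → Fin (suc n) → ℚ

detℚ zero    M = 1ℚ
detℚ (suc n) M = sum (laplaceTerm M)

laplaceTerm {n} M j = signℚ (toℕ j) * (M zero j * detℚ n (minorℚ M j))

signℚ-suc : ∀ i → signℚ (suc i) ≡ - signℚ i
signℚ-suc zero          = fromℤ-neg (ℤ.+ 1)
signℚ-suc (suc zero)    = trans (solve 1 (λ x → x := :- (:- x)) refl (fromℕ 1)) (cong -_ (sym (fromℤ-neg (ℤ.+ 1))))
signℚ-suc (suc (suc i)) = signℚ-suc i

sum-zero : ∀ n (f : Fin n → ℚ) → (∀ j → f j ≡ 0ℚ) → sum f ≡ 0ℚ
sum-zero zero    f f≡0 = refl
sum-zero (suc n) f f≡0 = cong₂ _+_ (f≡0 zero) (sum-zero n (f ∘ suc) (f≡0 ∘ suc))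

det-cong : ∀ n {M N : Matrix n} → (∀ i j → M i j ≡ N i j) → detℚ n M ≡ detℚ n N
det-cong zero    M≡N = refl
det-cong (suc n) M≡N = sum-cong-≗ λ j → cong (signℚ (toℕ j) *_)
  (cong₂ _*_ (M≡N zero j) (det-cong n (λ r c → M≡N (suc r) (punchIn j c))))

det-firstRowZero : ∀ n (M : Matrix (suc n)) → (∀ j → M zero (suc j) ≡ 0ℚ) →
  detℚ (suc n) M ≡ M zero zero * detℚ n (λ i j → M (suc i) (suc j))
det-firstRowZero n M row≡0 = trans
  (cong₂ _+_ (cong (_* (M zero zero * detℚ n (λ i j → M (suc i) (suc j)))) fromℕ-1) (sum-zero n (laplaceTerm M ∘ suc) vanish))
  (solve 2 (λ a d → con 1ℚ :* (a :* d) :+ con 0ℚ := a :* d) refl (M zero zero) (detℚ n (λ i j → M (suc i) (suc j))))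
  where
  vanish : ∀ j → laplaceTerm M (suc j) ≡ 0ℚ
  vanish j rewrite row≡0 j =
    solve 2 (λ s d → s :* (con 0ℚ :* d) := con 0ℚ) refl (signℚ (suc (toℕ j))) (detℚ n (minorℚ M (suc j)))

det-scaleRows : ∀ n (u : Fin n → ℚ) (N : Matrix n) →
  detℚ n (λ i j → u i * N i j) ≡ prod u * detℚ n N
det-scaleRows zero    u N = sym (ℚP.*-identityʳ 1ℚ)
det-scaleRows (suc n) u N = trans (sum-cong-≗ scaled) (sym (*-distribˡ-sum (prod u) (laplaceTerm N)))
  where
  scaled : ∀ j → laplaceTerm (λ i j → u i * N i j) j ≡ prod u * laplaceTerm N j
  scaled j rewrite det-scaleRows n (u ∘ suc) (minorℚ N j) =
    solve 5 (λ s a b p d → s :* ((a :* b) :* (p :* d)) := (a :* p) :* (s :* (b :* d))) refl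
      (signℚ (toℕ j)) (u zero) (N zero j) (prod (u ∘ suc)) (detℚ n (minorℚ N j))

det-scaleCols : ∀ n (v : Fin n → ℚ) (N : Matrix n) →
  detℚ n (λ i j → v j * N i j) ≡ prod v * detℚ n N
det-scaleCols zero    v N = sym (ℚP.*-identityʳ 1ℚ)
det-scaleCols (suc n) v N = trans (sum-cong-≗ scaled) (sym (*-distribˡ-sum (prod v) (laplaceTerm N)))
  where
  scaled : ∀ j → laplaceTerm (λ i j → v j * N i j) j ≡ prod v * laplaceTerm N j
  scaled j rewrite det-scaleCols n (v ∘ punchIn j) (minorℚ N j) | prod-remove {i = j} v =
    solve 5 (λ s a b p d → s :* ((a :* b) :* (p :* d)) := (a :* p) :* (s :* (b :* d))) refl
      (signℚ (toℕ j)) (v j) (N zero j) (prod (v ∘ punchIn j)) (detℚ n (minorℚ N j))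

det-linearCol : ∀ n (d : Fin n) (M N P : Matrix n) (x : ℚ) →
  (∀ i → P i d ≡ M i d + x * N i d) →
  (∀ i j → j ≢ d → P i j ≡ M i j) →
  (∀ i j → j ≢ d → N i j ≡ M i j) →
  detℚ n P ≡ detℚ n M + x * detℚ n N
det-linearCol (suc n) d M N P x col-d P-off N-off =
  trans (sum-cong-≗ term)
    (trans (∑-distrib-+ (laplaceTerm M) (λ j → x * laplaceTerm N j))
      (cong (λ D → detℚ (suc n) M + D) (sym (*-distribˡ-sum x (laplaceTerm N)))))
  where
  term : ∀ j → laplaceTerm P j ≡ laplaceTerm M j + x * laplaceTerm N j
  term j with j Fin.≟ d
  ... | yes refl =
    trans (cong₂ (λ a b → signℚ (toℕ j) * (a * b)) (col-d zero) minorP≡minorN)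
      (trans (solve 5 (λ s a x b D → s :* ((a :+ x :* b) :* D) := s :* (a :* D) :+ x :* (s :* (b :* D))) refl
                (signℚ (toℕ j)) (M zero j) x (N zero j) (detℚ n (minorℚ N j)))
        (cong (λ D → signℚ (toℕ j) * (M zero j * D) + x * laplaceTerm N j) (sym minorM≡minorN)))
    where
    minorM≡minorN : detℚ n (minorℚ M j) ≡ detℚ n (minorℚ N j)
    minorM≡minorN = det-cong n λ r c → sym (N-off (suc r) (punchIn j c) (FinP.punchInᵢ≢i j c))
    minorP≡minorN : detℚ n (minorℚ P j) ≡ detℚ n (minorℚ N j)
    minorP≡minorN = trans (det-cong n λ r c → P-off (suc r) (punchIn j c) (FinP.punchInᵢ≢i j c)) minorM≡minorN
  ... | no j≢d =
    trans (cong₂ (λ a D → signℚ (toℕ j) * (a * D)) (P-off zero j j≢d) minor-linear)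
      (trans (solve 5 (λ s a Dm x Dn → s :* (a :* (Dm :+ x :* Dn)) := s :* (a :* Dm) :+ x :* (s :* (a :* Dn))) refl
                (signℚ (toℕ j)) (M zero j) (detℚ n (minorℚ M j)) x (detℚ n (minorℚ N j)))
        (cong (λ a → laplaceTerm M j + x * (signℚ (toℕ j) * (a * detℚ n (minorℚ N j)))) (sym (N-off zero j j≢d))))
    where
    d′ = punchOut j≢d
    punchIn-d′ : punchIn j d′ ≡ d
    punchIn-d′ = FinP.punchIn-punchOut j≢d
    off-d′ : ∀ c → c ≢ d′ → punchIn j c ≢ d
    off-d′ c c≢d′ eq = c≢d′ (FinP.punchIn-injective j c d′ (trans eq (sym punchIn-d′)))
    minor-linear = det-linearCol n d′ (minorℚ M j) (minorℚ N j) (minorℚ P j) x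
      (λ r → subst (λ z → P (suc r) z ≡ M (suc r) z + x * N (suc r) z) (sym punchIn-d′) (col-d (suc r)))
      (λ r c c≢d′ → P-off (suc r) (punchIn j c) (off-d′ c c≢d′))
      (λ r c c≢d′ → N-off (suc r) (punchIn j c) (off-d′ c c≢d′))

inject₁≢suc : ∀ {m} (c : Fin m) → inject₁ c ≢ suc c
inject₁≢suc zero    ()
inject₁≢suc (suc c) eq = inject₁≢suc c (FinP.suc-injective eq)

sum-adjacentPair : ∀ {m} (c : Fin m) (t : Fin (suc m) → ℚ) →
  t (inject₁ c) + t (suc c) ≡ 0ℚ → (∀ j → j ≢ inject₁ c → j ≢ suc c → t j ≡ 0ℚ) → sum t ≡ 0ℚ
sum-adjacentPair {suc m} zero t pair others =
  trans (cong (λ s → t zero + (t (suc zero) + s)) (sum-zero m _ λ j → others (suc (suc j)) (λ ()) (λ ())))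
    (trans (solve 2 (λ a b → a :+ (b :+ con 0ℚ) := a :+ b) refl (t zero) (t (suc zero))) pair)
sum-adjacentPair (suc c) t pair others =
  cong₂ _+_ (others zero (λ ()) (λ ()))
    (sum-adjacentPair c (t ∘ suc) pair λ j j≢c j≢c+1 →
      others (suc j) (j≢c ∘ FinP.suc-injective) (j≢c+1 ∘ FinP.suc-injective))

punchIn-adjacent : ∀ {m} (c : Fin m) (x : Fin m) →
  punchIn (inject₁ c) x ≡ punchIn (suc c) x ⊎ (punchIn (inject₁ c) x ≡ suc c × punchIn (suc c) x ≡ inject₁ c)
punchIn-adjacent zero    zero    = inj₂ (refl , refl)
punchIn-adjacent zero    (suc x) = inj₁ refl
punchIn-adjacent (suc c) zero    = inj₁ refl
punchIn-adjacent (suc c) (suc x) with punchIn-adjacent c x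
... | inj₁ eq          = inj₁ (cong suc eq)
... | inj₂ (eq₁ , eq₂) = inj₂ (cong suc eq₁ , cong suc eq₂)

punchIn-avoidsAdjacent : ∀ {m} (c : Fin (suc m)) (j : Fin (suc (suc m))) → j ≢ inject₁ c → j ≢ suc c →
  Σ (Fin m) λ c′ → punchIn j (inject₁ c′) ≡ inject₁ c × punchIn j (suc c′) ≡ suc c
punchIn-avoidsAdjacent zero          zero          j≢c j≢c+1 = ⊥-elim (j≢c refl)
punchIn-avoidsAdjacent zero          (suc zero)    j≢c j≢c+1 = ⊥-elim (j≢c+1 refl)
punchIn-avoidsAdjacent {suc m} zero  (suc (suc j)) j≢c j≢c+1 = zero , refl , refl
punchIn-avoidsAdjacent {suc m} (suc c) zero        j≢c j≢c+1 = c , refl , refl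
punchIn-avoidsAdjacent {suc m} (suc c) (suc j)     j≢c j≢c+1 with punchIn-avoidsAdjacent c j (j≢c ∘ cong suc) (j≢c+1 ∘ cong suc)
... | c′ , eq₁ , eq₂ = suc c′ , cong suc eq₁ , cong suc eq₂

-- Expanding along the first row, only the terms of the two equal columns survive (the other
-- minors keep two equal adjacent columns), and these two cancel since their signs differ.
det-equalAdjacentCols : ∀ m (c : Fin m) (M : Matrix (suc m)) →
  (∀ i → M i (inject₁ c) ≡ M i (suc c)) → detℚ (suc m) M ≡ 0ℚ
det-equalAdjacentCols (suc m) c M equal = sum-adjacentPair c (laplaceTerm M) pair others
  where
  sameMinor : ∀ r x → M (suc r) (punchIn (inject₁ c) x) ≡ M (suc r) (punchIn (suc c) x)
  sameMinor r x with punchIn-adjacent c x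
  ... | inj₁ eq          = cong (M (suc r)) eq
  ... | inj₂ (eq₁ , eq₂) = trans (cong (M (suc r)) eq₁) (trans (sym (equal (suc r))) (cong (M (suc r)) (sym eq₂)))
  pair : laplaceTerm M (inject₁ c) + laplaceTerm M (suc c) ≡ 0ℚ
  pair rewrite det-cong (suc m) (sameMinor) | sym (equal zero) | signℚ-suc (toℕ c) | FinP.toℕ-inject₁ c =
    solve 3 (λ s a d → s :* (a :* d) :+ (:- s) :* (a :* d) := con 0ℚ) refl
      (signℚ (toℕ c)) (M zero (inject₁ c)) (detℚ (suc m) (minorℚ M (suc c)))
  others : ∀ j → j ≢ inject₁ c → j ≢ suc c → laplaceTerm M j ≡ 0ℚ
  others j j≢c j≢c+1 with punchIn-avoidsAdjacent c j j≢c j≢c+1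
  ... | c′ , eq₁ , eq₂ rewrite det-equalAdjacentCols m c′ (minorℚ M j)
                                 (λ r → trans (cong (M (suc r)) eq₁) (trans (equal (suc r)) (cong (M (suc r)) (sym eq₂)))) =
    solve 2 (λ s a → s :* (a :* con 0ℚ) := con 0ℚ) refl (signℚ (toℕ j)) (M zero j)

det-addAdjacentCol : ∀ m (c : Fin m) (M P : Matrix (suc m)) (x : ℚ) →
  (∀ i → P i (suc c) ≡ M i (suc c) + x * M i (inject₁ c)) →
  (∀ i j → j ≢ suc c → P i j ≡ M i j) → detℚ (suc m) P ≡ detℚ (suc m) M
det-addAdjacentCol m c M P x col off =
  trans (det-linearCol (suc m) (suc c) M N P x (λ i → trans (col i) (cong (λ z → M i (suc c) + x * z) (sym (N-col i)))) off N-off)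
    (trans (cong (λ D → detℚ (suc m) M + x * D)
              (det-equalAdjacentCols m c N λ i → trans (N-off i (inject₁ c) (inject₁≢suc c)) (sym (N-col i))))
      (solve 2 (λ a x → a :+ x :* con 0ℚ := a) refl (detℚ (suc m) M) x))
  where
  N : Matrix (suc m)
  N i j with j Fin.≟ suc c
  ... | yes _ = M i (inject₁ c)
  ... | no _  = M i j
  N-col : ∀ i → N i (suc c) ≡ M i (inject₁ c)
  N-col i with suc c Fin.≟ suc c
  ... | yes _ = refl
  ... | no ne = ⊥-elim (ne refl)
  N-off : ∀ i j → j ≢ suc c → N i j ≡ M i j
  N-off i j ne with j Fin.≟ suc c
  ... | yes eq = ⊥-elim (ne eq)
  ... | no _   = refl

detℕ : ∀ k → (ℕ → ℕ → ℚ) → ℚ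
detℕ k h = detℚ k (λ i j → h (toℕ i) (toℕ j))

detℕ-cong : ∀ k {g h : ℕ → ℕ → ℚ} → (∀ i j → j < k → g i j ≡ h i j) → detℕ k g ≡ detℕ k h
detℕ-cong k g≡h = det-cong k λ i j → g≡h (toℕ i) (toℕ j) (FinP.toℕ<n j)

detℕ-addAdjacentCol : ∀ k s (M P : ℕ → ℕ → ℚ) (x : ℚ) → suc s < k →
  (∀ i → P i (suc s) ≡ M i (suc s) + x * M i s) → (∀ i j → j ≢ suc s → P i j ≡ M i j) → detℕ k P ≡ detℕ k M
detℕ-addAdjacentCol (suc (suc m)) s M P x (s≤s (s≤s s≤m)) col off =
  det-addAdjacentCol (suc m) c (λ i j → M (toℕ i) (toℕ j)) (λ i j → P (toℕ i) (toℕ j)) x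
    (λ i → col′ (toℕ i))
    (λ i j j≢c+1 → off (toℕ i) (toℕ j) (λ eq → j≢c+1 (FinP.toℕ-injective (trans eq (cong suc (sym toℕ-c))))))
  where
  c = fromℕ< (s≤s s≤m)
  toℕ-c : toℕ c ≡ s
  toℕ-c = FinP.toℕ-fromℕ< (s≤s s≤m)
  col′ : ∀ i → P i (suc (toℕ c)) ≡ M i (suc (toℕ c)) + x * M i (toℕ (inject₁ c))
  col′ i rewrite FinP.toℕ-inject₁ c | toℕ-c = col i

sweepCols : (ℕ → ℕ → ℚ) → (ℕ → ℚ) → ℕ → ℕ → ℚ
sweepCols h x i zero    = h i zero
sweepCols h x i (suc j) = h i (suc j) + x j * h i j

module _ (h : ℕ → ℕ → ℚ) (x : ℕ → ℚ) where

  partialSweep : ℕ → ℕ → ℕ → ℚ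
  partialSweep t i j with t ≤? j
  ... | yes _ = sweepCols h x i j
  ... | no  _ = h i j

  partialSweep-≥ : ∀ t i j → t ≤ j → partialSweep t i j ≡ sweepCols h x i j
  partialSweep-≥ t i j t≤j with t ≤? j
  ... | yes _   = refl
  ... | no  t≰j = ⊥-elim (t≰j t≤j)

  partialSweep-< : ∀ t i j → j < t → partialSweep t i j ≡ h i j
  partialSweep-< t i j j<t with t ≤? j
  ... | yes t≤j = ⊥-elim (ℕP.<⇒≱ j<t t≤j)
  ... | no  _   = refl

  partialSweep-step : ∀ k s → suc s < k → detℕ k (partialSweep (suc s)) ≡ detℕ k (partialSweep (suc (suc s)))
  partialSweep-step k s s+1<k =
    detℕ-addAdjacentCol k s (partialSweep (suc (suc s))) (partialSweep (suc s)) (x s) s+1<k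
      (λ i → trans (partialSweep-≥ (suc s) i (suc s) ℕP.≤-refl)
               (sym (cong₂ (λ a b → a + x s * b)
                 (partialSweep-< (suc (suc s)) i (suc s) ℕP.≤-refl)
                 (partialSweep-< (suc (suc s)) i s (ℕP.m<n⇒m<1+n (ℕP.n<1+n s))))))
      unchanged
    where
    unchanged : ∀ i j → j ≢ suc s → partialSweep (suc s) i j ≡ partialSweep (suc (suc s)) i j
    unchanged i j j≢s+1 with ℕP.≤-<-connex (suc (suc s)) j
    ... | inj₁ s+2≤j = trans (partialSweep-≥ (suc s) i j (ℕP.≤-trans (ℕP.n≤1+n (suc s)) s+2≤j))
                             (sym (partialSweep-≥ (suc (suc s)) i j s+2≤j))
    ... | inj₂ j<s+2 = trans (partialSweep-< (suc s) i j (ℕP.≤∧≢⇒< (ℕP.≤-pred j<s+2) j≢s+1))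
                             (sym (partialSweep-< (suc (suc s)) i j j<s+2))

  partialSweep-done : ∀ k d s → suc s ℕ.+ d ≡ k → detℕ k (partialSweep (suc s)) ≡ detℕ k h
  partialSweep-done k zero    s refl =
    detℕ-cong k λ i j j<k → partialSweep-< (suc s) i j (subst (j <_) (ℕP.+-identityʳ (suc s)) j<k)
  partialSweep-done k (suc d) s refl =
    trans (partialSweep-step k s s+1<k) (partialSweep-done k d (suc s) (sym (ℕP.+-suc (suc s) d)))
    where
    s+1<k : suc s < suc s ℕ.+ suc d
    s+1<k = ℕP.m<m+n (suc s) (s≤s z≤n)

  det-sweepCols : ∀ k → detℕ k (sweepCols h x) ≡ detℕ k h
  det-sweepCols zero    = refl
  det-sweepCols (suc k) =
    trans (detℕ-cong (suc k) swept) (partialSweep-done (suc k) k 0 refl)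
    where
    swept : ∀ i j → j < suc k → sweepCols h x i j ≡ partialSweep 1 i j
    swept i zero    _ = sym (partialSweep-< 1 i 0 (s≤s z≤n))
    swept i (suc j) _ = sym (partialSweep-≥ 1 i (suc j) (s≤s z≤n))

∏< : ℕ → (ℕ → ℚ) → ℚ
∏< k φ = prod {k} (φ ∘ toℕ)

infixr 7.5 ∏<
syntax ∏< k (λ t → e) = ∏[ t < k ] e

∏-cong : ∀ k {φ ψ : ℕ → ℚ} → (∀ t → φ t ≡ ψ t) → ∏< k φ ≡ ∏< k ψ
∏-cong zero    φ≡ψ = refl
∏-cong (suc k) φ≡ψ = cong₂ _*_ (φ≡ψ 0) (∏-cong k (φ≡ψ ∘ suc))

∏-fromℕ-cong : ∀ k {φ ψ : ℕ → ℕ} → (∀ t → φ t ≡ ψ t) → ∏[ t < k ] fromℕ (φ t) ≡ ∏[ t < k ] fromℕ (ψ t)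
∏-fromℕ-cong k φ≡ψ = ∏-cong k (cong fromℕ ∘ φ≡ψ)

∏-distrib-* : ∀ k φ ψ → ∏[ t < k ] (φ t * ψ t) ≡ ∏< k φ * ∏< k ψ
∏-distrib-* zero    φ ψ = refl
∏-distrib-* (suc k) φ ψ = trans (cong (φ 0 * ψ 0 *_) (∏-distrib-* k (φ ∘ suc) (ψ ∘ suc)))
  (solve 4 (λ a b c d → (a :* b) :* (c :* d) := (a :* c) :* (b :* d)) refl (φ 0) (ψ 0) (∏< k (φ ∘ suc)) (∏< k (ψ ∘ suc)))

∏-const : ∀ k c → ∏[ t < k ] fromℕ c ≡ fromℕ (c ^ k)
∏-const zero    c = sym fromℕ-1
∏-const (suc k) c = trans (cong (fromℕ c *_) (∏-const k c)) (sym (fromℕ-* c (c ^ k)))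

*-cancelʳ : ∀ p .{{_ : ℚ.NonZero p}} {x y} → x * p ≡ y * p → x ≡ y
*-cancelʳ p {x} {y} eq = begin
  x                ≡⟨ sym (ℚP.*-identityʳ x) ⟩
  x * 1ℚ           ≡⟨ cong (x *_) (sym (ℚP.*-inverseʳ p)) ⟩
  x * (p * 1/ p)   ≡⟨ sym (ℚP.*-assoc x p (1/ p)) ⟩
  x * p * 1/ p     ≡⟨ cong (_* 1/ p) eq ⟩
  y * p * 1/ p     ≡⟨ ℚP.*-assoc y p (1/ p) ⟩
  y * (p * 1/ p)   ≡⟨ cong (y *_) (ℚP.*-inverseʳ p) ⟩
  y * 1ℚ           ≡⟨ ℚP.*-identityʳ y ⟩
  y                ∎

∏-cancelʳ : ∀ k (φ : ℕ → ℕ) → (∀ t → ℕ.NonZero (φ t)) → ∀ {x y} →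
  x * ∏[ t < k ] fromℕ (φ t) ≡ y * ∏[ t < k ] fromℕ (φ t) → x ≡ y
∏-cancelʳ zero    φ φ≢0 {x} {y} eq = trans (sym (ℚP.*-identityʳ x)) (trans eq (ℚP.*-identityʳ y))
∏-cancelʳ (suc k) φ φ≢0 {x} {y} eq = *-cancelʳ (fromℕ (φ 0)) {{fromℕ-nonZero (φ 0) {{φ≢0 0}}}}
  (∏-cancelʳ k (φ ∘ suc) (φ≢0 ∘ suc) (trans (ℚP.*-assoc x _ _) (trans eq (sym (ℚP.*-assoc y _ _)))))

-- F 0 m = C(2m, m), and F 1 m is the m-th Catalan number.
opaque
  F : ℕ → ℕ → ℚ
  F a m = fromℕ ((2 ℕ.* m) !) * (1/ fromℕ (m ! ℕ.* (m ℕ.+ a) !)) {{fromℕ-nonZero _ {{m ℕP.!* (m ℕ.+ a) !≢0}}}}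

opaque
  unfolding F

  F-spec : ∀ a m → F a m * fromℕ (m ! ℕ.* (m ℕ.+ a) !) ≡ fromℕ ((2 ℕ.* m) !)
  F-spec a m = trans (ℚP.*-assoc (fromℕ ((2 ℕ.* m) !)) _ (fromℕ (m ! ℕ.* (m ℕ.+ a) !)))
    (trans (cong (fromℕ ((2 ℕ.* m) !) *_)
                 (ℚP.*-inverseˡ (fromℕ (m ! ℕ.* (m ℕ.+ a) !)) {{fromℕ-nonZero _ {{m ℕP.!* (m ℕ.+ a) !≢0}}}}))
      (ℚP.*-identityʳ _))

2[1+m]! : ∀ m → (2 ℕ.* suc m) ! ≡ (2 ℕ.* m) ! ℕ.* (2 ℕ.* (2 ℕ.* m ℕ.+ 1) ℕ.* suc m)
2[1+m]! m = trans (cong _! (ℕP.*-suc 2 m)) (rearrange m ((2 ℕ.* m) !))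
  where
  rearrange : ∀ m x → suc (suc (2 ℕ.* m)) ℕ.* (suc (2 ℕ.* m) ℕ.* x) ≡ x ℕ.* (2 ℕ.* (2 ℕ.* m ℕ.+ 1) ℕ.* suc m)
  rearrange = ℕ-Solver.solve-∀

private
  F-scaled : ∀ a m u d → F a m * fromℕ u * fromℕ (m ! ℕ.* (m ℕ.+ a) ! ℕ.* d) ≡ fromℕ ((2 ℕ.* m) ! ℕ.* u ℕ.* d)
  F-scaled a m u d = begin
    F a m * fromℕ u * fromℕ (D ℕ.* d)          ≡⟨ cong (F a m * fromℕ u *_) (fromℕ-* D d) ⟩
    F a m * fromℕ u * (fromℕ D * fromℕ d)
      ≡⟨ solve 4 (λ f u D d → f :* u :* (D :* d) := f :* D :* u :* d) refl (F a m) (fromℕ u) (fromℕ D) (fromℕ d) ⟩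
    F a m * fromℕ D * fromℕ u * fromℕ d        ≡⟨ cong (λ z → z * fromℕ u * fromℕ d) (F-spec a m) ⟩
    fromℕ ((2 ℕ.* m) !) * fromℕ u * fromℕ d    ≡⟨ cong (_* fromℕ d) (sym (fromℕ-* ((2 ℕ.* m) !) u)) ⟩
    fromℕ ((2 ℕ.* m) ! ℕ.* u) * fromℕ d        ≡⟨ sym (fromℕ-* ((2 ℕ.* m) ! ℕ.* u) d) ⟩
    fromℕ ((2 ℕ.* m) ! ℕ.* u ℕ.* d)            ∎
    where
    D = m ! ℕ.* (m ℕ.+ a) !

F-cross : ∀ a m a′ m′ u v →
  (2 ℕ.* m′) ! ℕ.* u ℕ.* (m ! ℕ.* (m ℕ.+ a) !) ≡ (2 ℕ.* m) ! ℕ.* v ℕ.* (m′ ! ℕ.* (m′ ℕ.+ a′) !) →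
  F a′ m′ * fromℕ u ≡ F a m * fromℕ v
F-cross a m a′ m′ u v cross =
  *-cancelʳ (fromℕ (D′ ℕ.* D))
    {{fromℕ-nonZero _ {{ℕP.m*n≢0 D′ D {{m′ ℕP.!* (m′ ℕ.+ a′) !≢0}} {{m ℕP.!* (m ℕ.+ a) !≢0}}}}}}
    (trans (F-scaled a′ m′ u D)
      (trans (cong fromℕ cross)
        (trans (sym (F-scaled a m v D′)) (cong (λ z → F a m * fromℕ v * fromℕ z) (ℕP.*-comm D D′)))))
  where
  D = m ! ℕ.* (m ℕ.+ a) !
  D′ = m′ ! ℕ.* (m′ ℕ.+ a′) !

F-sucₘ : ∀ a m → F a (suc m) * fromℕ (suc (m ℕ.+ a)) ≡ F a m * fromℕ (2 ℕ.* (2 ℕ.* m ℕ.+ 1))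
F-sucₘ a m = F-cross a m a (suc m) _ _ (begin
  (2 ℕ.* suc m) ! ℕ.* suc (m ℕ.+ a) ℕ.* (m ! ℕ.* (m ℕ.+ a) !)
    ≡⟨ cong (λ z → z ℕ.* suc (m ℕ.+ a) ℕ.* (m ! ℕ.* (m ℕ.+ a) !)) (2[1+m]! m) ⟩
  (2 ℕ.* m) ! ℕ.* (2 ℕ.* (2 ℕ.* m ℕ.+ 1) ℕ.* suc m) ℕ.* suc (m ℕ.+ a) ℕ.* (m ! ℕ.* (m ℕ.+ a) !)
    ≡⟨ rearrange ((2 ℕ.* m) !) (2 ℕ.* (2 ℕ.* m ℕ.+ 1)) (suc m) (suc (m ℕ.+ a)) (m !) ((m ℕ.+ a) !) ⟩
  (2 ℕ.* m) ! ℕ.* (2 ℕ.* (2 ℕ.* m ℕ.+ 1)) ℕ.* (suc m ! ℕ.* (suc m ℕ.+ a) !) ∎)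
  where
  rearrange : ∀ f t m′ s g h → f ℕ.* (t ℕ.* m′) ℕ.* s ℕ.* (g ℕ.* h) ≡ f ℕ.* t ℕ.* ((m′ ℕ.* g) ℕ.* (s ℕ.* h))
  rearrange = ℕ-Solver.solve-∀

F-sucₐ : ∀ a m → F (suc a) m * fromℕ (suc (m ℕ.+ a)) ≡ F a m
F-sucₐ a m = trans (F-cross a m (suc a) m _ 1 (begin
  (2 ℕ.* m) ! ℕ.* suc (m ℕ.+ a) ℕ.* (m ! ℕ.* (m ℕ.+ a) !)
    ≡⟨ rearrange ((2 ℕ.* m) !) (suc (m ℕ.+ a)) (m !) ((m ℕ.+ a) !) ⟩
  (2 ℕ.* m) ! ℕ.* 1 ℕ.* (m ! ℕ.* suc (m ℕ.+ a) !)
    ≡⟨ cong (λ z → (2 ℕ.* m) ! ℕ.* 1 ℕ.* (m ! ℕ.* z !)) (sym (ℕP.+-suc m a)) ⟩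
  (2 ℕ.* m) ! ℕ.* 1 ℕ.* (m ! ℕ.* (m ℕ.+ suc a) !)           ∎))
  (trans (cong (F a m *_) fromℕ-1) (ℚP.*-identityʳ (F a m)))
  where
  rearrange : ∀ f s g h → f ℕ.* s ℕ.* (g ℕ.* h) ≡ f ℕ.* 1 ℕ.* (g ℕ.* (s ℕ.* h))
  rearrange = ℕ-Solver.solve-∀

nCk*[k!*[n∸k]!]≡n! : ∀ {n k} → k ℕ.≤ n → (n C k) ℕ.* (k ! ℕ.* (n ∸ k) !) ≡ n !
nCk*[k!*[n∸k]!]≡n! {n} {k} k≤n =
  trans (cong (ℕ._* (k ! ℕ.* (n ∸ k) !)) (nCk≡n!/k![n-k]! {n} {k} k≤n))
        (m/n*n≡m {{k ℕP.!* (n ∸ k) !≢0}} (k![n∸k]!∣n! k≤n))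

F-zero : ∀ m → F 0 m ≡ fromℕ ((2 ℕ.* m) C m)
F-zero m = *-cancelʳ (fromℕ D) {{fromℕ-nonZero D {{m ℕP.!* (m ℕ.+ 0) !≢0}}}}
  (trans (F-spec 0 m) (trans (cong fromℕ (sym 2mCm*D≡[2m]!)) (fromℕ-* ((2 ℕ.* m) C m) D)))
  where
  D = m ! ℕ.* (m ℕ.+ 0) !
  2m∸m≡m+0 : 2 ℕ.* m ∸ m ≡ m ℕ.+ 0
  2m∸m≡m+0 = trans (cong (_∸ m) (cong (m ℕ.+_) (ℕP.+-identityʳ m))) (trans (ℕP.m+n∸m≡n m m) (sym (ℕP.+-identityʳ m)))
  2mCm*D≡[2m]! : ((2 ℕ.* m) C m) ℕ.* D ≡ (2 ℕ.* m) !
  2mCm*D≡[2m]! = trans (cong (λ z → ((2 ℕ.* m) C m) ℕ.* (m ! ℕ.* z !)) (sym 2m∸m≡m+0))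
                       (nCk*[k!*[n∸k]!]≡n! (ℕP.m≤m+n m (m ℕ.+ 0)))

H : ℕ → ℕ → ℕ → ℚ
H a n k = detℕ k (λ i j → F a (n ℕ.+ i ℕ.+ j))

F-sucₘ′ : ∀ a m → F a (suc m) ≡ F (suc a) m * fromℕ (2 ℕ.* (2 ℕ.* m ℕ.+ 1))
F-sucₘ′ a m = *-cancelʳ (fromℕ (suc (m ℕ.+ a))) (begin
  F a (suc m) * fromℕ (suc (m ℕ.+ a))                     ≡⟨ F-sucₘ a m ⟩
  F a m * fromℕ W                                        ≡⟨ cong (_* fromℕ W) (sym (F-sucₐ a m)) ⟩
  F (suc a) m * fromℕ (suc (m ℕ.+ a)) * fromℕ W
    ≡⟨ solve 3 (λ f r w → f :* r :* w := f :* w :* r) refl (F (suc a) m) (fromℕ (suc (m ℕ.+ a))) (fromℕ W) ⟩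
  F (suc a) m * fromℕ W * fromℕ (suc (m ℕ.+ a))           ∎)
  where W = 2 ℕ.* (2 ℕ.* m ℕ.+ 1)

w-[t/s]r≡u/s : ∀ w t s r u → w ℕ.* suc s ≡ t ℕ.* r ℕ.+ u →
  fromℕ w + - (fromℕ t * 1/ fromℕ (suc s)) * fromℕ r ≡ fromℕ u * 1/ fromℕ (suc s)
w-[t/s]r≡u/s w t s r u ws≡tr+u = *-cancelʳ S (begin
  (fromℕ w + - (fromℕ t * 1/ S) * fromℕ r) * S
    ≡⟨ solve 5 (λ w t i r s → (w :+ :- (t :* i) :* r) :* s := w :* s :+ :- (t :* r) :* (i :* s)) refl
         (fromℕ w) (fromℕ t) (1/ S) (fromℕ r) S ⟩
  fromℕ w * S + - (fromℕ t * fromℕ r) * (1/ S * S)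
    ≡⟨ cong₂ (λ a b → a + - (fromℕ t * fromℕ r) * b) (sym (fromℕ-* w (suc s))) (ℚP.*-inverseˡ S) ⟩
  fromℕ (w ℕ.* suc s) + - (fromℕ t * fromℕ r) * 1ℚ
    ≡⟨ cong (λ z → fromℕ z + - (fromℕ t * fromℕ r) * 1ℚ) ws≡tr+u ⟩
  fromℕ (t ℕ.* r ℕ.+ u) + - (fromℕ t * fromℕ r) * 1ℚ
    ≡⟨ cong (λ z → z + - (fromℕ t * fromℕ r) * 1ℚ) (trans (fromℕ-+ (t ℕ.* r) u) (cong (_+ fromℕ u) (fromℕ-* t r))) ⟩
  fromℕ t * fromℕ r + fromℕ u + - (fromℕ t * fromℕ r) * 1ℚ
    ≡⟨ solve 3 (λ tr u i → tr :+ u :+ :- tr :* con 1ℚ := u :* con 1ℚ) refl (fromℕ t * fromℕ r) (fromℕ u) (1/ S) ⟩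
  fromℕ u * 1ℚ                                          ≡⟨ cong (fromℕ u *_) (sym (ℚP.*-inverseˡ S)) ⟩
  fromℕ u * (1/ S * S)                                  ≡⟨ sym (ℚP.*-assoc (fromℕ u) (1/ S) S) ⟩
  fromℕ u * 1/ S * S                                    ∎)
  where S = fromℕ (suc s)

rowProduct : ℕ → ℕ → ℚ
rowProduct a k = ∏[ i < k ] fromℕ (2 ℕ.* (2 ℕ.* a ℕ.+ 1) ℕ.* suc i)

-- The column factors depend on a and n only through s = n + a.
columnProduct : ℕ → ℕ → ℚ
columnProduct s k = ∏[ j < k ] 1/ fromℕ (suc (s ℕ.+ j))

-- Subtracting 2(2(n+j)+1)/(n+a+j+1) times column j from column j+1 (for all j at once) clears the
-- first row of the Hankel matrix and leaves F (a+1) (n+i+j) times factors depending on i or on j only.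
module Condensation (a n : ℕ) where

  hankel : ℕ → ℕ → ℚ
  hankel i j = F a (n ℕ.+ i ℕ.+ j)

  multiplier : ℕ → ℚ
  multiplier j = - (fromℕ (2 ℕ.* (2 ℕ.* (n ℕ.+ j) ℕ.+ 1)) * 1/ fromℕ (suc (n ℕ.+ a ℕ.+ j)))

  swept : ℕ → ℕ → ℚ
  swept = sweepCols hankel multiplier

  swept-suc : ∀ i j →
    swept i (suc j) ≡ F (suc a) (n ℕ.+ i ℕ.+ j) * (fromℕ (2 ℕ.* (2 ℕ.* a ℕ.+ 1) ℕ.* i) * 1/ fromℕ (suc (n ℕ.+ a ℕ.+ j)))
  swept-suc i j = begin
    F a (n ℕ.+ i ℕ.+ suc j) + multiplier j * F a (n ℕ.+ i ℕ.+ j)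
      ≡⟨ cong₂ (λ p q → p + multiplier j * q)
           (trans (cong (F a) (ℕP.+-suc (n ℕ.+ i) j)) (F-sucₘ′ a m)) (sym (F-sucₐ a m)) ⟩
    φ * fromℕ (2 ℕ.* (2 ℕ.* m ℕ.+ 1)) + multiplier j * (φ * fromℕ (suc (m ℕ.+ a)))
      ≡⟨ solve 4 (λ φ w x r → φ :* w :+ x :* (φ :* r) := φ :* (w :+ x :* r)) refl φ _ (multiplier j) _ ⟩
    φ * (fromℕ (2 ℕ.* (2 ℕ.* m ℕ.+ 1)) + multiplier j * fromℕ (suc (m ℕ.+ a)))
      ≡⟨ cong (φ *_) (w-[t/s]r≡u/s _ _ (n ℕ.+ a ℕ.+ j) _ _ (cross n i j a)) ⟩
    φ * (fromℕ (2 ℕ.* (2 ℕ.* a ℕ.+ 1) ℕ.* i) * 1/ fromℕ (suc (n ℕ.+ a ℕ.+ j))) ∎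
    where
    m = n ℕ.+ i ℕ.+ j
    φ = F (suc a) m
    cross : ∀ n i j a → 2 ℕ.* (2 ℕ.* (n ℕ.+ i ℕ.+ j) ℕ.+ 1) ℕ.* suc (n ℕ.+ a ℕ.+ j)
                      ≡ 2 ℕ.* (2 ℕ.* (n ℕ.+ j) ℕ.+ 1) ℕ.* suc (n ℕ.+ i ℕ.+ j ℕ.+ a) ℕ.+ 2 ℕ.* (2 ℕ.* a ℕ.+ 1) ℕ.* i
    cross = ℕ-Solver.solve-∀

  rowFactor columnFactor : ℕ → ℚ
  rowFactor i = fromℕ (2 ℕ.* (2 ℕ.* a ℕ.+ 1) ℕ.* suc i)
  columnFactor j = 1/ fromℕ (suc (n ℕ.+ a ℕ.+ j))

  firstRow-zero : ∀ j → swept 0 (suc j) ≡ 0ℚ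
  firstRow-zero j = begin
    swept 0 (suc j)                                                         ≡⟨ swept-suc 0 j ⟩
    F (suc a) (n ℕ.+ 0 ℕ.+ j) * (fromℕ (2 ℕ.* (2 ℕ.* a ℕ.+ 1) ℕ.* 0) * columnFactor j)
      ≡⟨ cong (λ z → F (suc a) (n ℕ.+ 0 ℕ.+ j) * (fromℕ z * columnFactor j)) (ℕP.*-zeroʳ (2 ℕ.* (2 ℕ.* a ℕ.+ 1))) ⟩
    F (suc a) (n ℕ.+ 0 ℕ.+ j) * (fromℕ 0 * columnFactor j)
      ≡⟨ cong (λ z → F (suc a) (n ℕ.+ 0 ℕ.+ j) * (z * columnFactor j)) fromℕ-0 ⟩
    F (suc a) (n ℕ.+ 0 ℕ.+ j) * (0ℚ * columnFactor j)
      ≡⟨ solve 2 (λ f c → f :* (con 0ℚ :* c) := con 0ℚ) refl (F (suc a) (n ℕ.+ 0 ℕ.+ j)) (columnFactor j) ⟩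
    0ℚ                                                                     ∎

  lower-entry : ∀ i j → swept (suc i) (suc j) ≡ rowFactor i * (columnFactor j * F (suc a) (suc n ℕ.+ i ℕ.+ j))
  lower-entry i j = trans (swept-suc (suc i) j)
    (trans (cong (λ m → F (suc a) (m ℕ.+ j) * (rowFactor i * columnFactor j)) (ℕP.+-suc n i))
      (solve 3 (λ f u v → f :* (u :* v) := u :* (v :* f)) refl (F (suc a) (suc n ℕ.+ i ℕ.+ j)) (rowFactor i) (columnFactor j)))

  condense : ∀ k → H a n (suc k) ≡ F a n * (rowProduct a k * (columnProduct (n ℕ.+ a) k * H (suc a) (suc n) k))
  condense k = begin
    H a n (suc k)
      ≡⟨ sym (det-sweepCols hankel multiplier (suc k)) ⟩
    detℕ (suc k) swept
      ≡⟨ det-firstRowZero k (λ i j → swept (toℕ i) (toℕ j)) (firstRow-zero ∘ toℕ) ⟩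
    swept 0 0 * detℕ k (λ i j → swept (suc i) (suc j))
      ≡⟨ cong₂ _*_ (cong (F a) (trans (ℕP.+-identityʳ _) (ℕP.+-identityʳ n))) (detℕ-cong k (λ i j _ → lower-entry i j)) ⟩
    F a n * detℕ k (λ i j → rowFactor i * (columnFactor j * F (suc a) (suc n ℕ.+ i ℕ.+ j)))
      ≡⟨ cong (F a n *_) (det-scaleRows k (rowFactor ∘ toℕ) _) ⟩
    F a n * (rowProduct a k * detℕ k (λ i j → columnFactor j * F (suc a) (suc n ℕ.+ i ℕ.+ j)))
      ≡⟨ cong (λ z → F a n * (rowProduct a k * z)) (det-scaleCols k (columnFactor ∘ toℕ) _) ⟩
    F a n * (rowProduct a k * (columnProduct (n ℕ.+ a) k * H (suc a) (suc n) k)) ∎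

H-condense : ∀ a n k → H a n (suc k) ≡ F a n * (rowProduct a k * (columnProduct (n ℕ.+ a) k * H (suc a) (suc n) k))
H-condense a n = Condensation.condense a n


fromℕ-inverseˡ : ∀ n → 1/ fromℕ (suc n) * fromℕ (suc n) ≡ 1ℚ
fromℕ-inverseˡ n = ℚP.*-inverseˡ (fromℕ (suc n))

columnProduct-suc : ∀ s k → columnProduct s (suc k) ≡ 1/ fromℕ (suc s) * columnProduct (suc s) k
columnProduct-suc s k = cong₂ _*_ (cong (λ m → 1/ fromℕ (suc m)) (ℕP.+-identityʳ s))
  (∏-cong k λ j → cong (λ m → 1/ fromℕ (suc m)) (ℕP.+-suc s j))

columnProduct-shift : ∀ s k → columnProduct (suc s) k * fromℕ (suc (s ℕ.+ k)) ≡ columnProduct s k * fromℕ (suc s)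
columnProduct-shift s zero = cong (λ m → 1ℚ * fromℕ (suc m)) (ℕP.+-identityʳ s)
columnProduct-shift s (suc k) = begin
  columnProduct (suc s) (suc k) * fromℕ (suc (s ℕ.+ suc k))
    ≡⟨ cong₂ _*_ (columnProduct-suc (suc s) k) (cong (fromℕ ∘ suc) (ℕP.+-suc s k)) ⟩
  1/ fromℕ (2 ℕ.+ s) * P₂ * fromℕ (suc (suc s ℕ.+ k))
    ≡⟨ ℚP.*-assoc (1/ fromℕ (2 ℕ.+ s)) P₂ _ ⟩
  1/ fromℕ (2 ℕ.+ s) * (P₂ * fromℕ (suc (suc s ℕ.+ k)))
    ≡⟨ cong (1/ fromℕ (2 ℕ.+ s) *_) (columnProduct-shift (suc s) k) ⟩
  1/ fromℕ (2 ℕ.+ s) * (P₁ * fromℕ (2 ℕ.+ s))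
    ≡⟨ solve 3 (λ i P x → i :* (P :* x) := (i :* x) :* P) refl (1/ fromℕ (2 ℕ.+ s)) P₁ (fromℕ (2 ℕ.+ s)) ⟩
  (1/ fromℕ (2 ℕ.+ s) * fromℕ (2 ℕ.+ s)) * P₁
    ≡⟨ cong (_* P₁) (trans (fromℕ-inverseˡ (suc s)) (sym (fromℕ-inverseˡ s))) ⟩
  (1/ fromℕ (suc s) * fromℕ (suc s)) * P₁
    ≡⟨ solve 3 (λ i P x → (i :* x) :* P := i :* P :* x) refl (1/ fromℕ (suc s)) P₁ (fromℕ (suc s)) ⟩
  1/ fromℕ (suc s) * P₁ * fromℕ (suc s)
    ≡⟨ cong (_* fromℕ (suc s)) (sym (columnProduct-suc s k)) ⟩
  columnProduct s (suc k) * fromℕ (suc s) ∎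
  where
  P₁ = columnProduct (suc s) k
  P₂ = columnProduct (2 ℕ.+ s) k

H-shiftₙ : ∀ k a n →
  H a (suc n) k * ∏[ t < k ] fromℕ (n ℕ.+ a ℕ.+ t ℕ.+ k) ≡ H a n k * ∏[ t < k ] fromℕ (2 ℕ.* (2 ℕ.* (n ℕ.+ t) ℕ.+ 1))
H-shiftₙ zero    a n = refl
H-shiftₙ (suc k) a n = begin
  H a (suc n) (suc k) * ∏[ t < suc k ] fromℕ (n ℕ.+ a ℕ.+ t ℕ.+ suc k)
    ≡⟨ cong₂ (λ h p → h * p) (H-condense a (suc n) k) (cong₂ _*_ (cong fromℕ (first n a k)) (∏-fromℕ-cong k (rest n a k))) ⟩
  F a (suc n) * (A * (C₁ * U)) * (fromℕ r * Q)
    ≡⟨ solve 7 (λ f A C U r Q s → f :* (A :* (C :* U)) :* (r :* Q) := f :* A :* (C :* r) :* (U :* Q)) refl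
         (F a (suc n)) A C₁ U (fromℕ r) Q (fromℕ s) ⟩
  F a (suc n) * A * (C₁ * fromℕ r) * (U * Q)
    ≡⟨ cong₂ (λ x y → F a (suc n) * A * x * y) (columnProduct-shift (n ℕ.+ a) k) (H-shiftₙ k (suc a) (suc n)) ⟩
  F a (suc n) * A * (C₀ * fromℕ s) * (V * O)
    ≡⟨ solve 6 (λ f A C s V O → f :* A :* (C :* s) :* (V :* O) := (f :* s) :* A :* C :* V :* O) refl
         (F a (suc n)) A C₀ (fromℕ s) V O ⟩
  F a (suc n) * fromℕ s * A * C₀ * V * O
    ≡⟨ cong (λ x → x * A * C₀ * V * O) (F-sucₘ a n) ⟩
  F a n * fromℕ w * A * C₀ * V * O
    ≡⟨ solve 6 (λ f w A C V O → f :* w :* A :* C :* V :* O := f :* (A :* (C :* V)) :* (w :* O)) refl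
         (F a n) (fromℕ w) A C₀ V O ⟩
  F a n * (A * (C₀ * V)) * (fromℕ w * O)
    ≡⟨ cong₂ _*_ (sym (H-condense a n k))
         (cong₂ _*_ (cong (λ m → fromℕ (2 ℕ.* (2 ℕ.* m ℕ.+ 1))) (sym (ℕP.+-identityʳ n)))
                    (∏-fromℕ-cong k λ t → cong (λ m → 2 ℕ.* (2 ℕ.* m ℕ.+ 1)) (sym (ℕP.+-suc n t)))) ⟩
  H a n (suc k) * ∏[ t < suc k ] fromℕ (2 ℕ.* (2 ℕ.* (n ℕ.+ t) ℕ.+ 1)) ∎
  where
  A = rowProduct a k
  C₀ = columnProduct (n ℕ.+ a) k
  C₁ = columnProduct (suc (n ℕ.+ a)) k
  U = H (suc a) (suc (suc n)) k
  V = H (suc a) (suc n) k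
  r = suc (n ℕ.+ a ℕ.+ k)
  s = suc (n ℕ.+ a)
  w = 2 ℕ.* (2 ℕ.* n ℕ.+ 1)
  Q = ∏[ t < k ] fromℕ (suc n ℕ.+ suc a ℕ.+ t ℕ.+ k)
  O = ∏[ t < k ] fromℕ (2 ℕ.* (2 ℕ.* (suc n ℕ.+ t) ℕ.+ 1))
  first : ∀ n a k → n ℕ.+ a ℕ.+ 0 ℕ.+ suc k ≡ suc (n ℕ.+ a ℕ.+ k)
  first = ℕ-Solver.solve-∀
  rest : ∀ n a k t → n ℕ.+ a ℕ.+ suc t ℕ.+ suc k ≡ suc n ℕ.+ suc a ℕ.+ t ℕ.+ k
  rest = ℕ-Solver.solve-∀

rowProduct-shift : ∀ a k → rowProduct (suc a) k * fromℕ ((2 ℕ.* a ℕ.+ 1) ^ k) ≡ rowProduct a k * fromℕ ((2 ℕ.* suc a ℕ.+ 1) ^ k)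
rowProduct-shift a k = begin
  rowProduct (suc a) k * fromℕ (c ^ k)
    ≡⟨ cong (rowProduct (suc a) k *_) (sym (∏-const k c)) ⟩
  rowProduct (suc a) k * ∏[ i < k ] fromℕ c
    ≡⟨ sym (∏-distrib-* k (λ i → fromℕ (2 ℕ.* (2 ℕ.* suc a ℕ.+ 1) ℕ.* suc i)) (λ _ → fromℕ c)) ⟩
  ∏[ i < k ] (fromℕ (2 ℕ.* (2 ℕ.* suc a ℕ.+ 1) ℕ.* suc i) * fromℕ c)
    ≡⟨ ∏-cong k (λ i → trans (sym (fromℕ-* (2 ℕ.* (2 ℕ.* suc a ℕ.+ 1) ℕ.* suc i) c))
                        (trans (cong fromℕ (swap a i)) (fromℕ-* (2 ℕ.* (2 ℕ.* a ℕ.+ 1) ℕ.* suc i) c′))) ⟩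
  ∏[ i < k ] (fromℕ (2 ℕ.* (2 ℕ.* a ℕ.+ 1) ℕ.* suc i) * fromℕ c′)
    ≡⟨ ∏-distrib-* k (λ i → fromℕ (2 ℕ.* (2 ℕ.* a ℕ.+ 1) ℕ.* suc i)) (λ _ → fromℕ c′) ⟩
  rowProduct a k * ∏[ i < k ] fromℕ c′                        ≡⟨ cong (rowProduct a k *_) (∏-const k c′) ⟩
  rowProduct a k * fromℕ (c′ ^ k)                             ∎
  where
  c = 2 ℕ.* a ℕ.+ 1
  c′ = 2 ℕ.* suc a ℕ.+ 1
  swap : ∀ a i → 2 ℕ.* (2 ℕ.* suc a ℕ.+ 1) ℕ.* suc i ℕ.* (2 ℕ.* a ℕ.+ 1)
               ≡ 2 ℕ.* (2 ℕ.* a ℕ.+ 1) ℕ.* suc i ℕ.* (2 ℕ.* suc a ℕ.+ 1)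
  swap = ℕ-Solver.solve-∀

H-1×1 : ∀ a n → H a n 1 ≡ F a n
H-1×1 a n = trans (H-condense a n 0) (solve 1 (λ f → f :* (con 1ℚ :* (con 1ℚ :* con 1ℚ)) := f) refl (F a n))

H-shiftₐ : ∀ k a n →
  H (suc a) n (suc k) * (fromℕ ((2 ℕ.* a ℕ.+ 1) ^ k) * ∏[ t < suc k ] fromℕ (n ℕ.+ a ℕ.+ t ℕ.+ suc k))
    ≡ H a n (suc k) * ∏[ u < k ] fromℕ (2 ℕ.* (a ℕ.+ u) ℕ.+ 3)
H-shiftₐ zero    a n = begin
  H (suc a) n 1 * (fromℕ 1 * (fromℕ (n ℕ.+ a ℕ.+ 0 ℕ.+ 1) * 1ℚ))
    ≡⟨ cong₂ (λ h m → h * (fromℕ 1 * (fromℕ m * 1ℚ))) (H-1×1 (suc a) n) (shuffle n a) ⟩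
  F (suc a) n * (fromℕ 1 * (fromℕ (suc (n ℕ.+ a)) * 1ℚ))
    ≡⟨ cong (λ o → F (suc a) n * (o * (fromℕ (suc (n ℕ.+ a)) * 1ℚ))) fromℕ-1 ⟩
  F (suc a) n * (1ℚ * (fromℕ (suc (n ℕ.+ a)) * 1ℚ))
    ≡⟨ solve 2 (λ f s → f :* (con 1ℚ :* (s :* con 1ℚ)) := f :* s :* con 1ℚ) refl (F (suc a) n) (fromℕ (suc (n ℕ.+ a))) ⟩
  F (suc a) n * fromℕ (suc (n ℕ.+ a)) * 1ℚ
    ≡⟨ cong (_* 1ℚ) (trans (F-sucₐ a n) (sym (H-1×1 a n))) ⟩
  H a n 1 * 1ℚ ∎
  where
  shuffle : ∀ n a → n ℕ.+ a ℕ.+ 0 ℕ.+ 1 ≡ suc (n ℕ.+ a)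
  shuffle = ℕ-Solver.solve-∀
H-shiftₐ (suc k) a n = begin
  H (suc a) n (2 ℕ.+ k) * (fromℕ (c ^ suc k) * ∏[ t < 2 ℕ.+ k ] fromℕ (n ℕ.+ a ℕ.+ t ℕ.+ (2 ℕ.+ k)))
    ≡⟨ cong₂ (λ h p → h * (fromℕ (c ^ suc k) * p)) (H-condense (suc a) n (suc k))
         (cong₂ _*_ (cong fromℕ (first n a k)) (∏-fromℕ-cong (suc k) (rest n a k))) ⟩
  F (suc a) n * (A₁ * (C₁ * W)) * (fromℕ (c ^ suc k) * (fromℕ r * Q))
    ≡⟨ solve 8 (λ f A C W p r Q c′ → f :* (A :* (C :* W)) :* (p :* (r :* Q)) := f :* (A :* p) :* (C :* r) :* (W :* Q)) refl
         (F (suc a) n) A₁ C₁ W (fromℕ (c ^ suc k)) (fromℕ r) Q (fromℕ c′) ⟩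
  F (suc a) n * (A₁ * fromℕ (c ^ suc k)) * (C₁ * fromℕ r) * (W * Q)
    ≡⟨ cong₂ (λ x y → F (suc a) n * x * y * (W * Q)) (rowProduct-shift a (suc k))
         (trans (cong (λ s → columnProduct s (suc k) * fromℕ r) (ℕP.+-suc n a)) (columnProduct-shift (n ℕ.+ a) (suc k))) ⟩
  F (suc a) n * (A₀ * fromℕ (c′ ^ suc k)) * (C₀ * fromℕ s) * (W * Q)
    ≡⟨ cong (λ x → F (suc a) n * (A₀ * x) * (C₀ * fromℕ s) * (W * Q)) (fromℕ-* c′ (c′ ^ k)) ⟩
  F (suc a) n * (A₀ * (fromℕ c′ * fromℕ (c′ ^ k))) * (C₀ * fromℕ s) * (W * Q)
    ≡⟨ solve 8 (λ f A c′ p C s W Q → f :* (A :* (c′ :* p)) :* (C :* s) :* (W :* Q)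
                                   := (f :* s) :* (A :* (C :* (W :* (p :* Q)))) :* c′) refl
         (F (suc a) n) A₀ (fromℕ c′) (fromℕ (c′ ^ k)) C₀ (fromℕ s) W Q ⟩
  F (suc a) n * fromℕ s * (A₀ * (C₀ * (W * (fromℕ (c′ ^ k) * Q)))) * fromℕ c′
    ≡⟨ cong₂ (λ x y → x * (A₀ * (C₀ * y)) * fromℕ c′) (F-sucₐ a n) (H-shiftₐ k (suc a) (suc n)) ⟩
  F a n * (A₀ * (C₀ * (V * O))) * fromℕ c′
    ≡⟨ solve 6 (λ f A C V O c′ → f :* (A :* (C :* (V :* O))) :* c′ := f :* (A :* (C :* V)) :* (c′ :* O)) refl
         (F a n) A₀ C₀ V O (fromℕ c′) ⟩
  F a n * (A₀ * (C₀ * V)) * (fromℕ c′ * O)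
    ≡⟨ cong₂ _*_ (sym (H-condense a n (suc k)))
         (cong₂ _*_ (cong fromℕ (first′ a)) (∏-fromℕ-cong k (rest′ a))) ⟩
  H a n (2 ℕ.+ k) * ∏[ u < suc k ] fromℕ (2 ℕ.* (a ℕ.+ u) ℕ.+ 3) ∎
  where
  c = 2 ℕ.* a ℕ.+ 1
  c′ = 2 ℕ.* suc a ℕ.+ 1
  A₀ = rowProduct a (suc k)
  A₁ = rowProduct (suc a) (suc k)
  C₀ = columnProduct (n ℕ.+ a) (suc k)
  C₁ = columnProduct (n ℕ.+ suc a) (suc k)
  W = H (2 ℕ.+ a) (suc n) (suc k)
  V = H (suc a) (suc n) (suc k)
  r = suc (n ℕ.+ a ℕ.+ suc k)
  s = suc (n ℕ.+ a)
  Q = ∏[ t < suc k ] fromℕ (suc n ℕ.+ suc a ℕ.+ t ℕ.+ suc k)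
  O = ∏[ u < k ] fromℕ (2 ℕ.* (suc a ℕ.+ u) ℕ.+ 3)
  first : ∀ n a k → n ℕ.+ a ℕ.+ 0 ℕ.+ (2 ℕ.+ k) ≡ suc (n ℕ.+ a ℕ.+ suc k)
  first = ℕ-Solver.solve-∀
  rest : ∀ n a k t → n ℕ.+ a ℕ.+ suc t ℕ.+ (2 ℕ.+ k) ≡ suc n ℕ.+ suc a ℕ.+ t ℕ.+ suc k
  rest = ℕ-Solver.solve-∀
  first′ : ∀ a → 2 ℕ.* suc a ℕ.+ 1 ≡ 2 ℕ.* (a ℕ.+ 0) ℕ.+ 3
  first′ = ℕ-Solver.solve-∀
  rest′ : ∀ a u → 2 ℕ.* (suc a ℕ.+ u) ℕ.+ 3 ≡ 2 ℕ.* (a ℕ.+ suc u) ℕ.+ 3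
  rest′ = ℕ-Solver.solve-∀

∏ℕ< : ℕ → (ℕ → ℕ) → ℕ
∏ℕ< zero    φ = 1
∏ℕ< (suc k) φ = φ 0 ℕ.* ∏ℕ< k (φ ∘ suc)

infixr 7.5 ∏ℕ<
syntax ∏ℕ< k (λ t → e) = ∏ℕ[ t < k ] e

∏ℕ-cong : ∀ k {φ ψ : ℕ → ℕ} → (∀ t → φ t ≡ ψ t) → ∏ℕ< k φ ≡ ∏ℕ< k ψ
∏ℕ-cong zero    φ≡ψ = refl
∏ℕ-cong (suc k) φ≡ψ = cong₂ ℕ._*_ (φ≡ψ 0) (∏ℕ-cong k (φ≡ψ ∘ suc))

fromℕ-∏ℕ : ∀ k φ → fromℕ (∏ℕ< k φ) ≡ ∏[ t < k ] fromℕ (φ t)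
fromℕ-∏ℕ zero    φ = fromℕ-1
fromℕ-∏ℕ (suc k) φ = trans (fromℕ-* (φ 0) _) (cong (fromℕ (φ 0) *_) (fromℕ-∏ℕ k (φ ∘ suc)))

∏ℕ-nonZero : ∀ k φ → (∀ t → NonZero (φ t)) → NonZero (∏ℕ< k φ)
∏ℕ-nonZero zero    φ φ≢0 = _
∏ℕ-nonZero (suc k) φ φ≢0 = ℕP.m*n≢0 (φ 0) _ {{φ≢0 0}} {{∏ℕ-nonZero k (φ ∘ suc) (φ≢0 ∘ suc)}}

∏ℕ-rising : ∀ k c → ∏ℕ[ t < k ] (c ℕ.+ t ℕ.+ 1) ℕ.* c ! ≡ (c ℕ.+ k) !
∏ℕ-rising zero    c = trans (ℕP.+-identityʳ (c !)) (cong _! (sym (ℕP.+-identityʳ c)))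
∏ℕ-rising (suc k) c = begin
  (c ℕ.+ 0 ℕ.+ 1) ℕ.* ∏ℕ[ t < k ] (c ℕ.+ suc t ℕ.+ 1) ℕ.* c !
    ≡⟨ cong₂ (λ x P → x ℕ.* P ℕ.* c !) (first c) (∏ℕ-cong k (rest c)) ⟩
  suc c ℕ.* R ℕ.* c !                                  ≡⟨ rearrange (suc c) R (c !) ⟩
  R ℕ.* suc c !                                      ≡⟨ ∏ℕ-rising k (suc c) ⟩
  (suc c ℕ.+ k) !                                    ≡⟨ cong _! (sym (ℕP.+-suc c k)) ⟩
  (c ℕ.+ suc k) !                                    ∎
  where
  R = ∏ℕ[ t < k ] (suc c ℕ.+ t ℕ.+ 1)
  first : ∀ c → c ℕ.+ 0 ℕ.+ 1 ≡ suc c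
  first = ℕ-Solver.solve-∀
  rest : ∀ c t → c ℕ.+ suc t ℕ.+ 1 ≡ suc c ℕ.+ t ℕ.+ 1
  rest = ℕ-Solver.solve-∀
  rearrange : ∀ x R f → x ℕ.* R ℕ.* f ≡ R ℕ.* (x ℕ.* f)
  rearrange = ℕ-Solver.solve-∀

∏ℕ-double : ∀ k n →
  ∏ℕ[ t < k ] (2 ℕ.* (2 ℕ.* (n ℕ.+ t) ℕ.+ 1)) ℕ.* ∏ℕ[ t < k ] (n ℕ.+ t ℕ.+ 1) ℕ.* (2 ℕ.* n) !
    ≡ (2 ℕ.* n ℕ.+ 2 ℕ.* k) !
∏ℕ-double zero    n = trans (ℕP.+-identityʳ ((2 ℕ.* n) !)) (cong _! (sym (ℕP.+-identityʳ (2 ℕ.* n))))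
∏ℕ-double (suc k) n = begin
  2 ℕ.* (2 ℕ.* (n ℕ.+ 0) ℕ.+ 1) ℕ.* O′ ℕ.* ((n ℕ.+ 0 ℕ.+ 1) ℕ.* R′) ℕ.* (2 ℕ.* n) !
    ≡⟨ cong₂ (λ O R → 2 ℕ.* (2 ℕ.* (n ℕ.+ 0) ℕ.+ 1) ℕ.* O ℕ.* ((n ℕ.+ 0 ℕ.+ 1) ℕ.* R) ℕ.* (2 ℕ.* n) !)
         (∏ℕ-cong k λ t → cong (λ m → 2 ℕ.* (2 ℕ.* m ℕ.+ 1)) (ℕP.+-suc n t))
         (∏ℕ-cong k λ t → cong (ℕ._+ 1) (ℕP.+-suc n t)) ⟩
  2 ℕ.* (2 ℕ.* (n ℕ.+ 0) ℕ.+ 1) ℕ.* O ℕ.* ((n ℕ.+ 0 ℕ.+ 1) ℕ.* R) ℕ.* (2 ℕ.* n) !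
    ≡⟨ rearrange n O R ((2 ℕ.* n) !) ⟩
  O ℕ.* R ℕ.* ((2 ℕ.* n) ! ℕ.* (2 ℕ.* (2 ℕ.* n ℕ.+ 1) ℕ.* suc n))   ≡⟨ cong (O ℕ.* R ℕ.*_) (sym (2[1+m]! n)) ⟩
  O ℕ.* R ℕ.* (2 ℕ.* suc n) !                             ≡⟨ ∏ℕ-double k (suc n) ⟩
  (2 ℕ.* suc n ℕ.+ 2 ℕ.* k) !                             ≡⟨ cong _! (shift n k) ⟩
  (2 ℕ.* n ℕ.+ 2 ℕ.* suc k) !                             ∎
  where
  O′ = ∏ℕ[ t < k ] (2 ℕ.* (2 ℕ.* (n ℕ.+ suc t) ℕ.+ 1))
  R′ = ∏ℕ[ t < k ] (n ℕ.+ suc t ℕ.+ 1)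
  O = ∏ℕ[ t < k ] (2 ℕ.* (2 ℕ.* (suc n ℕ.+ t) ℕ.+ 1))
  R = ∏ℕ[ t < k ] (suc n ℕ.+ t ℕ.+ 1)
  rearrange : ∀ n O R f → 2 ℕ.* (2 ℕ.* (n ℕ.+ 0) ℕ.+ 1) ℕ.* O ℕ.* ((n ℕ.+ 0 ℕ.+ 1) ℕ.* R) ℕ.* f
                        ≡ O ℕ.* R ℕ.* (f ℕ.* (2 ℕ.* (2 ℕ.* n ℕ.+ 1) ℕ.* suc n))
  rearrange = ℕ-Solver.solve-∀
  shift : ∀ n k → 2 ℕ.* suc n ℕ.+ 2 ℕ.* k ≡ 2 ℕ.* n ℕ.+ 2 ℕ.* suc k
  shift = ℕ-Solver.solve-∀

∏ℕ-duplication : ∀ k → ∏ℕ[ t < k ] (k ℕ.+ t ℕ.+ 1) ≡ ∏ℕ[ t < k ] (2 ℕ.* (2 ℕ.* t ℕ.+ 1))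
∏ℕ-duplication k = ℕP.*-cancelʳ-≡ _ _ (k !) {{k ℕP.!≢0}} (begin
  ∏ℕ[ t < k ] (k ℕ.+ t ℕ.+ 1) ℕ.* k !                         ≡⟨ ∏ℕ-rising k k ⟩
  (k ℕ.+ k) !
    ≡⟨ cong _! (cong (k ℕ.+_) (sym (ℕP.+-identityʳ k))) ⟩
  (2 ℕ.* k) !                                             ≡⟨ sym (∏ℕ-double k 0) ⟩
  ∏ℕ[ t < k ] (2 ℕ.* (2 ℕ.* t ℕ.+ 1)) ℕ.* ∏ℕ[ t < k ] (t ℕ.+ 1) ℕ.* 1
    ≡⟨ ℕP.*-assoc (∏ℕ[ t < k ] (2 ℕ.* (2 ℕ.* t ℕ.+ 1))) (∏ℕ[ t < k ] (t ℕ.+ 1)) 1 ⟩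
  ∏ℕ[ t < k ] (2 ℕ.* (2 ℕ.* t ℕ.+ 1)) ℕ.* (∏ℕ[ t < k ] (t ℕ.+ 1) ℕ.* 1)
    ≡⟨ cong (∏ℕ[ t < k ] (2 ℕ.* (2 ℕ.* t ℕ.+ 1)) ℕ.*_) (∏ℕ-rising k 0) ⟩
  ∏ℕ[ t < k ] (2 ℕ.* (2 ℕ.* t ℕ.+ 1)) ℕ.* k !                    ∎)

∏ℕ-duplication′ : ∀ k → ∏ℕ[ t < suc k ] (k ℕ.+ t ℕ.+ 1) ≡ ∏ℕ[ t < k ] (2 ℕ.* (2 ℕ.* t ℕ.+ 3))
∏ℕ-duplication′ k = ℕP.*-cancelʳ-≡ _ _ (suc k ! ℕ.* 2) {{ℕP.m*n≢0 (suc k !) 2 {{suc k ℕP.!≢0}}}} (begin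
  E ℕ.* (suc k ! ℕ.* 2)                              ≡⟨ rearrange E (k !) k ⟩
  E ℕ.* k ! ℕ.* (2 ℕ.* suc k)                          ≡⟨ cong (ℕ._* (2 ℕ.* suc k)) (∏ℕ-rising (suc k) k) ⟩
  (k ℕ.+ suc k) ! ℕ.* (2 ℕ.* suc k)                    ≡⟨ double-suc k ((k ℕ.+ suc k) !) ⟩
  suc (k ℕ.+ suc k) ℕ.* (k ℕ.+ suc k) !                ≡⟨ cong _! (shift k) ⟩
  (2 ℕ.* 1 ℕ.+ 2 ℕ.* k) !                              ≡⟨ sym (∏ℕ-double k 1) ⟩
  O ℕ.* R ℕ.* 2                                      ≡⟨ rearrange′ O R ⟩
  O ℕ.* (R ℕ.* 1 ℕ.* 2)                                ≡⟨ cong (λ x → O ℕ.* (x ℕ.* 2)) (∏ℕ-rising k 1) ⟩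
  O ℕ.* (suc k ! ℕ.* 2)                              ≡⟨ cong (ℕ._* (suc k ! ℕ.* 2)) (∏ℕ-cong k odd) ⟩
  ∏ℕ[ t < k ] (2 ℕ.* (2 ℕ.* t ℕ.+ 3)) ℕ.* (suc k ! ℕ.* 2)   ∎)
  where
  E = ∏ℕ[ t < suc k ] (k ℕ.+ t ℕ.+ 1)
  O = ∏ℕ[ t < k ] (2 ℕ.* (2 ℕ.* (1 ℕ.+ t) ℕ.+ 1))
  R = ∏ℕ[ t < k ] (1 ℕ.+ t ℕ.+ 1)
  rearrange : ∀ E f k → E ℕ.* ((suc k) ℕ.* f ℕ.* 2) ≡ E ℕ.* f ℕ.* (2 ℕ.* suc k)
  rearrange = ℕ-Solver.solve-∀
  double-suc : ∀ k f → f ℕ.* (2 ℕ.* suc k) ≡ suc (k ℕ.+ suc k) ℕ.* f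
  double-suc = ℕ-Solver.solve-∀
  shift : ∀ k → suc (k ℕ.+ suc k) ≡ 2 ℕ.* 1 ℕ.+ 2 ℕ.* k
  shift = ℕ-Solver.solve-∀
  rearrange′ : ∀ O R → O ℕ.* R ℕ.* 2 ≡ O ℕ.* (R ℕ.* 1 ℕ.* 2)
  rearrange′ = ℕ-Solver.solve-∀
  odd : ∀ t → 2 ℕ.* (2 ℕ.* (1 ℕ.+ t) ℕ.+ 1) ≡ 2 ℕ.* (2 ℕ.* t ℕ.+ 3)
  odd = ℕ-Solver.solve-∀

∏ℕ-double-centralBinomial : ∀ k n →
  ∏ℕ[ t < k ] (2 ℕ.* (2 ℕ.* (n ℕ.+ t) ℕ.+ 1)) ℕ.* ((2 ℕ.* n) C n) ℕ.* (n ! ℕ.* (n ℕ.+ k) !) ≡ (2 ℕ.* n ℕ.+ 2 ℕ.* k) !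
∏ℕ-double-centralBinomial k n = begin
  O ℕ.* ((2 ℕ.* n) C n) ℕ.* (n ! ℕ.* (n ℕ.+ k) !)
    ≡⟨ cong (λ x → O ℕ.* ((2 ℕ.* n) C n) ℕ.* (n ! ℕ.* x)) (sym (∏ℕ-rising k n)) ⟩
  O ℕ.* ((2 ℕ.* n) C n) ℕ.* (n ! ℕ.* (R ℕ.* n !))
    ≡⟨ rearrange O ((2 ℕ.* n) C n) (n !) R ⟩
  O ℕ.* R ℕ.* (((2 ℕ.* n) C n) ℕ.* (n ! ℕ.* n !))
    ≡⟨ cong (λ x → O ℕ.* R ℕ.* (((2 ℕ.* n) C n) ℕ.* (n ! ℕ.* x !))) (sym 2n∸n≡n) ⟩
  O ℕ.* R ℕ.* (((2 ℕ.* n) C n) ℕ.* (n ! ℕ.* (2 ℕ.* n ∸ n) !))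
    ≡⟨ cong (O ℕ.* R ℕ.*_) (nCk*[k!*[n∸k]!]≡n! (ℕP.m≤m+n n (n ℕ.+ 0))) ⟩
  O ℕ.* R ℕ.* (2 ℕ.* n) !
    ≡⟨ ∏ℕ-double k n ⟩
  (2 ℕ.* n ℕ.+ 2 ℕ.* k) ! ∎
  where
  O = ∏ℕ[ t < k ] (2 ℕ.* (2 ℕ.* (n ℕ.+ t) ℕ.+ 1))
  R = ∏ℕ[ t < k ] (n ℕ.+ t ℕ.+ 1)
  2n∸n≡n : 2 ℕ.* n ∸ n ≡ n
  2n∸n≡n = trans (cong (λ x → n ℕ.+ x ∸ n) (ℕP.+-identityʳ n)) (ℕP.m+n∸m≡n n n)
  rearrange : ∀ O C f R → O ℕ.* C ℕ.* (f ℕ.* (R ℕ.* f)) ≡ O ℕ.* R ℕ.* (C ℕ.* (f ℕ.* f))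
  rearrange = ℕ-Solver.solve-∀

∏ℕ-rising-shiftedBinomial : ∀ k n →
  2 ℕ.* ((2 ℕ.* suc k ∸ 1 ℕ.+ 2 ℕ.* n) C n) ℕ.* ∏ℕ[ t < suc k ] (n ℕ.+ t ℕ.+ suc k) ℕ.* (n ! ℕ.* (n ℕ.+ suc k) !)
    ≡ (2 ℕ.* n ℕ.+ 2 ℕ.* suc k) !
∏ℕ-rising-shiftedBinomial k n = begin
  2 ℕ.* (N C n) ℕ.* P ℕ.* (n ! ℕ.* (n ℕ.+ suc k) !)
    ≡⟨ cong (λ x → 2 ℕ.* (N C n) ℕ.* P ℕ.* (n ! ℕ.* x !)) (ℕP.+-suc n k) ⟩
  2 ℕ.* (N C n) ℕ.* P ℕ.* (n ! ℕ.* (suc (n ℕ.+ k) ℕ.* (n ℕ.+ k) !))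
    ≡⟨ rearrange (suc (n ℕ.+ k)) (N C n) (n !) P ((n ℕ.+ k) !) ⟩
  2 ℕ.* suc (n ℕ.+ k) ℕ.* ((N C n) ℕ.* (n ! ℕ.* (P ℕ.* (n ℕ.+ k) !)))
    ≡⟨ cong₂ (λ x y → x ℕ.* ((N C n) ℕ.* (n ! ℕ.* y))) (sym N+1≡2[n+k+1]) P*[n+k]! ⟩
  suc N ℕ.* ((N C n) ℕ.* (n ! ℕ.* (n ℕ.+ k ℕ.+ suc k) !))
    ≡⟨ cong (λ x → suc N ℕ.* ((N C n) ℕ.* (n ! ℕ.* x !))) (sym N∸n≡m) ⟩
  suc N ℕ.* ((N C n) ℕ.* (n ! ℕ.* (N ∸ n) !))
    ≡⟨ cong (suc N ℕ.*_) (nCk*[k!*[n∸k]!]≡n! n≤N) ⟩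
  suc N ℕ.* N !
    ≡⟨ cong _! (sym N+1) ⟩
  (2 ℕ.* n ℕ.+ 2 ℕ.* suc k) ! ∎
  where
  P = ∏ℕ[ t < suc k ] (n ℕ.+ t ℕ.+ suc k)
  N = 2 ℕ.* suc k ∸ 1 ℕ.+ 2 ℕ.* n
  m = n ℕ.+ k ℕ.+ suc k
  N≡n+m : N ≡ n ℕ.+ m
  N≡n+m = trans (cong (λ x → x ∸ 1 ℕ.+ 2 ℕ.* n) (ℕP.*-suc 2 k)) (expand n k)
    where
    expand : ∀ n k → suc (2 ℕ.* k) ℕ.+ 2 ℕ.* n ≡ n ℕ.+ (n ℕ.+ k ℕ.+ suc k)
    expand = ℕ-Solver.solve-∀
  N∸n≡m : N ∸ n ≡ m
  N∸n≡m = trans (cong (_∸ n) N≡n+m) (ℕP.m+n∸m≡n n m)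
  n≤N : n ℕ.≤ N
  n≤N = subst (n ℕ.≤_) (sym N≡n+m) (ℕP.m≤m+n n m)
  N+1 : 2 ℕ.* n ℕ.+ 2 ℕ.* suc k ≡ suc N
  N+1 = trans (expand n k) (cong suc (sym N≡n+m))
    where
    expand : ∀ n k → 2 ℕ.* n ℕ.+ 2 ℕ.* suc k ≡ suc (n ℕ.+ (n ℕ.+ k ℕ.+ suc k))
    expand = ℕ-Solver.solve-∀
  N+1≡2[n+k+1] : suc N ≡ 2 ℕ.* suc (n ℕ.+ k)
  N+1≡2[n+k+1] = trans (cong suc N≡n+m) (expand n k)
    where
    expand : ∀ n k → suc (n ℕ.+ (n ℕ.+ k ℕ.+ suc k)) ≡ 2 ℕ.* suc (n ℕ.+ k)
    expand = ℕ-Solver.solve-∀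
  P*[n+k]! : P ℕ.* (n ℕ.+ k) ! ≡ (n ℕ.+ k ℕ.+ suc k) !
  P*[n+k]! = trans (cong (ℕ._* (n ℕ.+ k) !) (∏ℕ-cong (suc k) (shuffle n k))) (∏ℕ-rising (suc k) (n ℕ.+ k))
    where
    shuffle : ∀ n k t → n ℕ.+ t ℕ.+ suc k ≡ n ℕ.+ k ℕ.+ t ℕ.+ 1
    shuffle = ℕ-Solver.solve-∀
  rearrange : ∀ s D f P g → 2 ℕ.* D ℕ.* P ℕ.* (f ℕ.* (s ℕ.* g)) ≡ 2 ℕ.* s ℕ.* (D ℕ.* (f ℕ.* (P ℕ.* g)))
  rearrange = ℕ-Solver.solve-∀

∏ℕ-centralBinomial : ∀ k n →
  ∏ℕ[ t < suc k ] (2 ℕ.* (2 ℕ.* (n ℕ.+ t) ℕ.+ 1)) ℕ.* ((2 ℕ.* n) C n)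
    ≡ 2 ℕ.* ((2 ℕ.* suc k ∸ 1 ℕ.+ 2 ℕ.* n) C n) ℕ.* ∏ℕ[ t < suc k ] (n ℕ.+ t ℕ.+ suc k)
∏ℕ-centralBinomial k n = ℕP.*-cancelʳ-≡ _ _ (n ! ℕ.* (n ℕ.+ suc k) !) {{n ℕP.!* (n ℕ.+ suc k) !≢0}}
  (trans (∏ℕ-double-centralBinomial (suc k) n) (sym (∏ℕ-rising-shiftedBinomial k n)))

H-0-0 : ∀ k → H 0 0 (suc k) ≡ fromℕ (2 ^ k)
H-1-0 : ∀ k → H 1 0 (suc k) ≡ 1ℚ
H-1-1 : ∀ k → H 1 1 k ≡ 1ℚ

H-0-0 k = begin
  H 0 0 (suc k)                                              ≡⟨ H-condense 0 0 k ⟩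
  F 0 0 * (rowProduct 0 k * (columnProduct 0 k * H 1 1 k))
    ≡⟨ cong₂ (λ f h → f * (rowProduct 0 k * (columnProduct 0 k * h))) (trans (F-zero 0) fromℕ-1) (H-1-1 k) ⟩
  1ℚ * (rowProduct 0 k * (columnProduct 0 k * 1ℚ))
    ≡⟨ solve 2 (λ R C → con 1ℚ :* (R :* (C :* con 1ℚ)) := R :* C) refl (rowProduct 0 k) (columnProduct 0 k) ⟩
  rowProduct 0 k * columnProduct 0 k
    ≡⟨ sym (∏-distrib-* k (λ i → fromℕ (2 ℕ.* suc i)) (λ i → 1/ fromℕ (suc i))) ⟩
  ∏[ i < k ] (fromℕ (2 ℕ.* suc i) * 1/ fromℕ (suc i))        ≡⟨ ∏-cong k halve ⟩
  ∏[ i < k ] fromℕ 2                                         ≡⟨ ∏-const k 2 ⟩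
  fromℕ (2 ^ k)                                              ∎
  where
  halve : ∀ i → fromℕ (2 ℕ.* suc i) * 1/ fromℕ (suc i) ≡ fromℕ 2
  halve i = trans (cong (_* 1/ fromℕ (suc i)) (fromℕ-* 2 (suc i)))
    (trans (ℚP.*-assoc (fromℕ 2) _ _) (trans (cong (fromℕ 2 *_) (ℚP.*-inverseʳ (fromℕ (suc i)))) (ℚP.*-identityʳ (fromℕ 2))))

H-1-0 k = ∏-cancelʳ (suc k) (λ t → t ℕ.+ suc k) (λ t → ℕ.≢-nonZero (ℕP.m+1+n≢0 t)) (begin
  H 1 0 (suc k) * E
    ≡⟨ cong (H 1 0 (suc k) *_) (trans (sym (ℚP.*-identityˡ E)) (cong (_* E) (sym 1^k≡1))) ⟩
  H 1 0 (suc k) * (fromℕ (1 ^ k) * E)                ≡⟨ H-shiftₐ k 0 0 ⟩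
  H 0 0 (suc k) * ∏[ u < k ] fromℕ (2 ℕ.* u ℕ.+ 3)   ≡⟨ cong (_* ∏[ u < k ] fromℕ (2 ℕ.* u ℕ.+ 3)) (H-0-0 k) ⟩
  fromℕ (2 ^ k) * ∏[ u < k ] fromℕ (2 ℕ.* u ℕ.+ 3)   ≡⟨ powers-of-two ⟩
  E                                                  ≡⟨ ℚP.*-identityˡ E ⟨
  1ℚ * E                                             ∎)
  where
  E = ∏[ t < suc k ] fromℕ (t ℕ.+ suc k)
  1^k≡1 : fromℕ (1 ^ k) ≡ 1ℚ
  1^k≡1 = trans (cong fromℕ (ℕP.^-zeroˡ k)) fromℕ-1
  powers-of-two : fromℕ (2 ^ k) * ∏[ u < k ] fromℕ (2 ℕ.* u ℕ.+ 3) ≡ E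
  powers-of-two = begin
    fromℕ (2 ^ k) * ∏[ u < k ] fromℕ (2 ℕ.* u ℕ.+ 3)
      ≡⟨ cong (_* ∏[ u < k ] fromℕ (2 ℕ.* u ℕ.+ 3)) (∏-const k 2) ⟨
    ∏[ u < k ] fromℕ 2 * ∏[ u < k ] fromℕ (2 ℕ.* u ℕ.+ 3)
      ≡⟨ ∏-distrib-* k (λ _ → fromℕ 2) (λ u → fromℕ (2 ℕ.* u ℕ.+ 3)) ⟨
    ∏[ u < k ] (fromℕ 2 * fromℕ (2 ℕ.* u ℕ.+ 3))              ≡⟨ ∏-cong k (λ u → fromℕ-* 2 (2 ℕ.* u ℕ.+ 3)) ⟨
    ∏[ u < k ] fromℕ (2 ℕ.* (2 ℕ.* u ℕ.+ 3))
      ≡⟨ trans (sym (fromℕ-∏ℕ k _)) (cong fromℕ (sym (∏ℕ-duplication′ k))) ⟩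
    fromℕ (∏ℕ[ t < suc k ] (k ℕ.+ t ℕ.+ 1))                    ≡⟨ fromℕ-∏ℕ (suc k) (λ t → k ℕ.+ t ℕ.+ 1) ⟩
    ∏[ t < suc k ] fromℕ (k ℕ.+ t ℕ.+ 1)                       ≡⟨ ∏-fromℕ-cong (suc k) (shuffle k) ⟩
    E                                                          ∎
    where
    shuffle : ∀ k t → k ℕ.+ t ℕ.+ 1 ≡ t ℕ.+ suc k
    shuffle = ℕ-Solver.solve-∀

H-1-1 zero    = refl
H-1-1 (suc k) = ∏-cancelʳ (suc k) (λ t → suc (t ℕ.+ suc k)) (λ _ → _) (begin
  H 1 1 (suc k) * E                                          ≡⟨ H-shiftₙ (suc k) 1 0 ⟩
  H 1 0 (suc k) * ∏[ t < suc k ] fromℕ (2 ℕ.* (2 ℕ.* t ℕ.+ 1)) ≡⟨ cong₂ _*_ (H-1-0 k) odd≡E ⟩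
  1ℚ * E                                                     ∎)
  where
  E = ∏[ t < suc k ] fromℕ (suc (t ℕ.+ suc k))
  odd≡E : ∏[ t < suc k ] fromℕ (2 ℕ.* (2 ℕ.* t ℕ.+ 1)) ≡ E
  odd≡E = begin
    ∏[ t < suc k ] fromℕ (2 ℕ.* (2 ℕ.* t ℕ.+ 1))   ≡⟨ fromℕ-∏ℕ (suc k) (λ t → 2 ℕ.* (2 ℕ.* t ℕ.+ 1)) ⟨
    fromℕ (∏ℕ[ t < suc k ] (2 ℕ.* (2 ℕ.* t ℕ.+ 1))) ≡⟨ cong fromℕ (∏ℕ-duplication (suc k)) ⟨
    fromℕ (∏ℕ[ t < suc k ] (suc k ℕ.+ t ℕ.+ 1))     ≡⟨ fromℕ-∏ℕ (suc k) (λ t → suc k ℕ.+ t ℕ.+ 1) ⟩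
    ∏[ t < suc k ] fromℕ (suc k ℕ.+ t ℕ.+ 1)        ≡⟨ ∏-fromℕ-cong (suc k) (shuffle k) ⟩
    E                                               ∎
    where
    shuffle : ∀ k t → suc k ℕ.+ t ℕ.+ 1 ≡ suc (t ℕ.+ suc k)
    shuffle = ℕ-Solver.solve-∀

fromℤ-sumFin : ∀ n (f : Fin n → ℤ) → fromℤ (sumFin n f) ≡ sum (fromℤ ∘ f)
fromℤ-sumFin zero    f = fromℕ-0
fromℤ-sumFin (suc n) f = trans (fromℤ-+ (f zero) _) (cong (fromℤ (f zero) ℚ.+_) (fromℤ-sumFin n (f ∘ suc)))

fromℤ-det : ∀ n (M : Fin n → Fin n → ℤ) → fromℤ (det n M) ≡ detℚ n (λ i j → fromℤ (M i j))
fromℤ-det zero    M = fromℕ-1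
fromℤ-det (suc n) M = trans (fromℤ-sumFin (suc n) (λ j → sign (toℕ j) ℤ.* (M zero j ℤ.* det n (minor M j))))
  (sum-cong-≗ λ j → trans (fromℤ-* (sign (toℕ j)) _)
    (cong (signℚ (toℕ j) *_) (trans (fromℤ-* (M zero j) _) (cong (fromℤ (M zero j) *_) (fromℤ-det n (minor M j))))))

fromℤ-hankelDet : ∀ n k → fromℤ (det k (hankelMatrix n k)) ≡ H 0 n k
fromℤ-hankelDet n k = trans (fromℤ-det k (hankelMatrix n k)) (det-cong k λ i j →
  trans (cong (λ m → fromℕ (m C (n ℕ.+ toℕ i ℕ.+ toℕ j))) (double n (toℕ i) (toℕ j)))
        (sym (F-zero (n ℕ.+ toℕ i ℕ.+ toℕ j))))
  where
  double : ∀ n i j → 2 ℕ.* n ℕ.+ 2 ℕ.* i ℕ.+ 2 ℕ.* j ≡ 2 ℕ.* (n ℕ.+ i ℕ.+ j)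
  double = ℕ-Solver.solve-∀

prod1to-last : ∀ n g → g 0 ≡ 1 → prod1to n g ≡ prod1to (n ∸ 1) g ℕ.* g n
prod1to-last zero    g g0≡1 = cong (1 ℕ.*_) (sym g0≡1)
prod1to-last (suc n) g g0≡1 = refl

H₀-shiftₙ : ∀ k n →
  H 0 (suc n) k * fromℕ (∏ℕ[ t < k ] (n ℕ.+ t ℕ.+ k)) ≡ H 0 n k * fromℕ (∏ℕ[ t < k ] (2 ℕ.* (2 ℕ.* (n ℕ.+ t) ℕ.+ 1)))
H₀-shiftₙ k n = begin
  H 0 (suc n) k * fromℕ (∏ℕ[ t < k ] (n ℕ.+ t ℕ.+ k))
    ≡⟨ cong (H 0 (suc n) k *_)
         (trans (fromℕ-∏ℕ k _) (∏-fromℕ-cong k λ t → cong (λ m → m ℕ.+ t ℕ.+ k) (sym (ℕP.+-identityʳ n)))) ⟩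
  H 0 (suc n) k * ∏[ t < k ] fromℕ (n ℕ.+ 0 ℕ.+ t ℕ.+ k) ≡⟨ H-shiftₙ k 0 n ⟩
  H 0 n k * ∏[ t < k ] fromℕ (2 ℕ.* (2 ℕ.* (n ℕ.+ t) ℕ.+ 1)) ≡⟨ cong (H 0 n k *_) (sym (fromℕ-∏ℕ k _)) ⟩
  H 0 n k * fromℕ (∏ℕ[ t < k ] (2 ℕ.* (2 ℕ.* (n ℕ.+ t) ℕ.+ 1))) ∎

module _ (k : ℕ) where

  centralBinomial shiftedBinomial : ℕ → ℕ
  centralBinomial j = (2 ℕ.* j) C j
  shiftedBinomial j = (2 ℕ.* suc k ∸ 1 ℕ.+ 2 ℕ.* j) C j

  H₀-closedForm : ∀ n → H 0 n (suc k) * fromℕ (prod1to (n ∸ 1) centralBinomial)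
                      ≡ fromℕ (2 ^ k ℕ.* (2 ^ n ℕ.* prod1to (n ∸ 1) shiftedBinomial))
  H₀-closedForm zero    =
    trans (cong₂ _*_ (H-0-0 k) fromℕ-1) (trans (ℚP.*-identityʳ _) (cong fromℕ (sym (ℕP.*-identityʳ (2 ^ k)))))
  H₀-closedForm (suc n) = *-cancelʳ (fromℕ P) {{fromℕ-nonZero P {{P≢0}}}} (begin
    H 0 (suc n) (suc k) * fromℕ (prod1to n centralBinomial) * fromℕ P
      ≡⟨ cong (λ x → H 0 (suc n) (suc k) * fromℕ x * fromℕ P) (prod1to-last n centralBinomial refl) ⟩
    H 0 (suc n) (suc k) * fromℕ (B ℕ.* centralBinomial n) * fromℕ P
      ≡⟨ solve 3 (λ h b p → h :* b :* p := h :* p :* b) refl (H 0 (suc n) (suc k)) (fromℕ (B ℕ.* centralBinomial n)) (fromℕ P) ⟩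
    H 0 (suc n) (suc k) * fromℕ P * fromℕ (B ℕ.* centralBinomial n)
      ≡⟨ cong₂ _*_ (H₀-shiftₙ (suc k) n) (fromℕ-* B (centralBinomial n)) ⟩
    H 0 n (suc k) * fromℕ O * (fromℕ B * fromℕ (centralBinomial n))
      ≡⟨ solve 4 (λ h o b c → h :* o :* (b :* c) := h :* b :* (o :* c)) refl
           (H 0 n (suc k)) (fromℕ O) (fromℕ B) (fromℕ (centralBinomial n)) ⟩
    H 0 n (suc k) * fromℕ B * (fromℕ O * fromℕ (centralBinomial n))
      ≡⟨ cong₂ _*_ (H₀-closedForm n) (trans (sym (fromℕ-* O (centralBinomial n))) (cong fromℕ (∏ℕ-centralBinomial k n))) ⟩
    fromℕ X * fromℕ (2 ℕ.* shiftedBinomial n ℕ.* P)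
      ≡⟨ trans (sym (fromℕ-* X _)) (cong fromℕ (rearrange (2 ^ k) (2 ^ n) S (shiftedBinomial n) P)) ⟩
    fromℕ (2 ^ k ℕ.* (2 ^ suc n ℕ.* (S ℕ.* shiftedBinomial n)) ℕ.* P)
      ≡⟨ cong (λ x → fromℕ (2 ^ k ℕ.* (2 ^ suc n ℕ.* x) ℕ.* P)) (sym (prod1to-last n shiftedBinomial refl)) ⟩
    fromℕ (2 ^ k ℕ.* (2 ^ suc n ℕ.* prod1to n shiftedBinomial) ℕ.* P)
      ≡⟨ fromℕ-* _ P ⟩
    fromℕ (2 ^ k ℕ.* (2 ^ suc n ℕ.* prod1to n shiftedBinomial)) * fromℕ P ∎)
    where
    P = ∏ℕ[ t < suc k ] (n ℕ.+ t ℕ.+ suc k)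
    O = ∏ℕ[ t < suc k ] (2 ℕ.* (2 ℕ.* (n ℕ.+ t) ℕ.+ 1))
    B = prod1to (n ∸ 1) centralBinomial
    S = prod1to (n ∸ 1) shiftedBinomial
    X = 2 ^ k ℕ.* (2 ^ n ℕ.* S)
    P≢0 : ℕ.NonZero P
    P≢0 = ∏ℕ-nonZero (suc k) (λ t → n ℕ.+ t ℕ.+ suc k) λ t → ℕ.≢-nonZero (ℕP.m+1+n≢0 (n ℕ.+ t))
    rearrange : ∀ a b s g p → a ℕ.* (b ℕ.* s) ℕ.* (2 ℕ.* g ℕ.* p) ≡ a ℕ.* (2 ℕ.* b ℕ.* (s ℕ.* g)) ℕ.* p
    rearrange = ℕ-Solver.solve-∀

mainTheorem7 : ∀ (n k' : ℕ) →
  det (suc k') (hankelMatrix n (suc k')) ℤ.* + (prod1to (n ∸ 1) (λ j → (2 ℕ.* j) C j))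
    ≡ + (2 ^ k' ℕ.* (2 ^ n ℕ.* prod1to (n ∸ 1) (λ j → (2 ℕ.* suc k' ∸ 1 ℕ.+ 2 ℕ.* j) C j)))
mainTheorem7 n k' = fromℤ-injective (begin
  fromℤ (det (suc k') (hankelMatrix n (suc k')) ℤ.* + prod1to (n ∸ 1) (centralBinomial k'))
    ≡⟨ fromℤ-* (det (suc k') (hankelMatrix n (suc k'))) _ ⟩
  fromℤ (det (suc k') (hankelMatrix n (suc k'))) * fromℕ (prod1to (n ∸ 1) (centralBinomial k'))
    ≡⟨ cong (_* fromℕ (prod1to (n ∸ 1) (centralBinomial k'))) (fromℤ-hankelDet n (suc k')) ⟩
  H 0 n (suc k') * fromℕ (prod1to (n ∸ 1) (centralBinomial k'))
    ≡⟨ H₀-closedForm k' n ⟩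
  fromℕ (2 ^ k' ℕ.* (2 ^ n ℕ.* prod1to (n ∸ 1) (shiftedBinomial k'))) ∎)
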